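{- Let $A\in{\sf ASM}(n)$ and let $\mathcal Ess(A)=\{(i_1,j_1),\ldots,(i_k,j_k)\}$. Then (1) $A=A_{\boldsymbol\beta_A,\mathbf b_A}$, where $\boldsymbol\beta_A=(\beta^{(1)},\ldots,\beta^{(k)})$ with $\beta^{(\ell)}$ the rectangular partition with $i_\ell-r_A(i_\ell,j_\ell)$ parts all equal to $j_\ell-r_A(i_\ell,j_\ell)$, and $\mathbf b_A=(i_1,\ldots,i_k)$; (2) $A=A_{\boldsymbol\rho_A,\mathbf p_A}$, where $\mathbf p_A=(p_1,\ldots,p_m)$ lists the distinct row indices $i$ occurring in elements $(i,j)\in\mathcal Ess(A)$ and $\boldsymbol\rho_A=(\lambda^{(A,p_1)},\ldots,\lambda^{(A,p_m)})$.
   Context: An ASM of size $n$ is an $n\times n$ matrix $A=(a_{ij})$ with entries in $\{ -1,0,1\}$ whose nonzero entries alternate in sign along each row and column, and each row and column sums to 1. $r_A(i,j)=\sum_{k\le i,\,l\le j}a_{kl}$. Order: $A\le B$ iff $r_A\ge r_B$ entrywise; the join $\vee$ of a set of ASMs is the ASM whose corner sum function is the entrywise minimum. Permutations are identified with their permutation matrices (1 at $(i,w(i))$). Diagram: $(i,j)$ is an inversion of $A$ if $\sum_{k>i,\,l>j}a_{il}a_{kj}=1$; $D(A)$ is the set of inversions, and $\mathcal Ess(A)=\{(i,j)\in D(A):(i+1,j)\notin D(A),\ (i,j+1)\notin D(A)\}$. Monotone triangle: for $1\le\ell\le n$, exactly $\ell$ column indices $j$ satisfy $\sum_{k\le\ell}a_{kj}=1$;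 list them as $m_A(\ell,1)<\cdots<m_A(\ell,\ell)$, and set $\lambda^{(A,\ell)}=(m_A(\ell,\ell)-\ell,\ m_A(\ell,\ell-1)-(\ell-1),\ldots,m_A(\ell,1)-1)$, a partition. For a tuple of partitions $\boldsymbol\lambda=(\lambda^{(1)},\ldots,\lambda^{(k)})$ and positive integers $\mathbf d=(d_1,\ldots,d_k)$ with $\ell(\lambda^{(i)})\le d_i$ and $\lambda^{(i)}_1\le n-d_i$: $[\lambda,d]_g\in\mathcal S_n$ is the permutation $u$ with $u(t)=\lambda_{d-t+1}+t$ for $t\le d$ and $u(d+1)<\cdots<u(n)$ (identity if $\lambda$ is empty), and $A_{\boldsymbol\lambda,\mathbf d}=\vee\{[\lambda^{(i)},d_i]_g\}$ (the join of the empty set being the identity matrix). -}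

module Defs where

open import Data.Nat as ℕ using (ℕ; zero; suc; _∸_; _<?_; _<ᵇ_; _⊓_)
open import Data.Integer as ℤ using (ℤ; +_; -_; _-_; ∣_∣)
open import Data.Fin using (Fin; toℕ; fromℕ<)
open import Data.List using (List; []; _∷_; map; filter; upTo; _++_; replicate; reverse; zipWith; length; foldr)
open import Data.List.Membership.DecPropositional ℕ._≟_ using (_∈?_)
open import Data.Bool using (if_then_else_; _∧_)
open import Data.Product using (_×_; _,_)
open import Data.Sum using (_⊎_)
import Data.Fin
open import Relation.Nullary using (¬_; yes; no; ¬?)
open import Relation.Binary.PropositionalEquality using (_≡_; _≢_)

-- n × n integer matrices, indexed by Fin n (row, column); 0-based internally.
Mat : ℕ → Set
Mat n = Fin n → Fin n → ℤ

_≋_ : ∀ {n} → Mat n → Mat n → Set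
A ≋ B = ∀ i j → A i j ≡ B i j

sumF : ∀ {n} → (Fin n → ℤ) → ℤ
sumF {zero}  f = + 0
sumF {suc n} f = f Data.Fin.zero ℤ.+ sumF (λ k → f (Data.Fin.suc k))

record IsASM {n : ℕ} (A : Mat n) : Set where
  field
    entries : ∀ i j → (A i j ≡ + 0) ⊎ ((A i j ≡ + 1) ⊎ (A i j ≡ - + 1))
    rowSum  : ∀ i → sumF (λ j → A i j) ≡ + 1
    colSum  : ∀ j → sumF (λ i → A i j) ≡ + 1
    rowAlt  : ∀ i j j' → toℕ j ℕ.< toℕ j' → A i j ≢ + 0 → A i j' ≢ + 0 →
              (∀ l → toℕ j ℕ.< toℕ l → toℕ l ℕ.< toℕ j' → A i l ≡ + 0) →
              A i j' ≡ - A i j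
    colAlt  : ∀ j i i' → toℕ i ℕ.< toℕ i' → A i j ≢ + 0 → A i' j ≢ + 0 →
              (∀ l → toℕ i ℕ.< toℕ l → toℕ l ℕ.< toℕ i' → A l j ≡ + 0) →
              A i' j ≡ - A i j

-- 1-based access to entries; 0 outside 1..n
at : ∀ {n} → Mat n → ℕ → ℕ → ℤ
at {n} A (suc i) (suc j) with i <? n | j <? n
... | yes p | yes q = A (fromℕ< p) (fromℕ< q)
... | _     | _     = + 0
at A _ _ = + 0

sumR : ℕ → (ℕ → ℤ) → ℤ
sumR zero    f = + 0
sumR (suc m) f = sumR m f ℤ.+ f (suc m)

r : ∀ {n} → Mat n → ℕ → ℕ → ℤ
r A i j = sumR i (λ k → sumR j (λ l → at A k l))

-- Join: the matrix whose corner sum function is the entrywise minimum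
-- (the corner sum function of the empty join is that of the identity, min(i,j)).
joinR : ∀ {n} → List (Mat n) → ℕ → ℕ → ℤ
joinR L i j = foldr (λ B m → m ℤ.⊓ r B i j) (+ (i ⊓ j)) L

fromR : ∀ {n} → (ℕ → ℕ → ℤ) → Mat n
fromR R k l = let i = suc (toℕ k) ; j = suc (toℕ l) in
  ((R i j ℤ.- R (i ∸ 1) j) ℤ.- R i (j ∸ 1)) ℤ.+ R (i ∸ 1) (j ∸ 1)

join : ∀ {n} → List (Mat n) → Mat n
join L = fromR (joinR L)

-- list lookup, 1-based, default 0 (λ_k = 0 beyond the length)
part : List ℕ → ℕ → ℕ
part []       _             = 0
part (x ∷ xs) zero          = 0
part (x ∷ xs) (suc zero)    = x
part (x ∷ xs) (suc (suc k)) = part xs (suc k)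

-- one-line notation of [λ,d]_g in S_n
gword : ℕ → List ℕ → ℕ → List ℕ
gword n lam d = first ++ filter (λ c → ¬? (c ∈? first)) (map suc (upTo n))
  where
  first : List ℕ
  first = map (λ t → part lam (d ∸ suc t ℕ.+ 1) ℕ.+ suc t) (upTo d)

permMat : ∀ {n} → List ℕ → Mat n
permMat w i j with part w (suc (toℕ i)) ℕ.≟ suc (toℕ j)
... | yes _ = + 1
... | no  _ = + 0

Alam : (n : ℕ) → List (List ℕ × ℕ) → Mat n
Alam n L = join (map (λ { (lam , d) → permMat (gword n lam d) }) L)

InD : ∀ {n} → Mat n → ℕ → ℕ → Set
InD {n} A i j =
  (1 ℕ.≤ i) × (i ℕ.≤ n) × (1 ℕ.≤ j) × (j ℕ.≤ n) ×
  (sumR n (λ k → sumR n (λ l →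
     if (i <ᵇ k) ∧ (j <ᵇ l) then at A i l ℤ.* at A k j else + 0)) ≡ + 1)

Ess : ∀ {n} → Mat n → ℕ → ℕ → Set
Ess A i j = InD A i j × ¬ InD A (suc i) j × ¬ InD A i (suc j)

rect : ℕ → ℕ → List ℕ
rect a b = replicate a b

-- monotone triangle row ℓ: columns j with Σ_{k≤ℓ} a_{kj} = 1, increasing
mtRow : ∀ {n} → Mat n → ℕ → List ℕ
mtRow {n} A ℓ = filter (λ j → sumR ℓ (λ k → at A k j) ℤ.≟ + 1) (map suc (upTo n))

mtPart : ∀ {n} → Mat n → ℕ → List ℕ
mtPart A ℓ = reverse (zipWith _∸_ (mtRow A ℓ) (map suc (upTo (length (mtRow A ℓ)))))

module Submission where

-- Everything is phrased through corner sums r = r_A.  Partial row and column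
-- sums of an ASM are 0 or 1 (an alternation argument), so r is 1-Lipschitz in
-- each argument, and (i,j) lies in the diagram iff both partial sums at (i,j)
-- vanish.  Walking from a cell (a,b) with r(a,b) < min(a,b) up/left across
-- partial sums equal to 1, and then down/right inside the diagram, reaches an
-- essential cell (i,j) with r(i,j) + (a-i) + (b-j) ≤ r(a,b).  On the other
-- side, the Grassmannian permutation with first letters F has corner sums
-- min(a,c) + min(a-|F|, b-c), c = #(F ∩ [1,b]); for both families this lies
-- above r and is at most the bound above at its own essential cell.  Since
-- join corner sums are entrywise minima and a matrix is determined by its
-- corner sums, A equals either join.

open import Defs
open import Data.Nat as ℕ
  using (ℕ; zero; suc; z≤n; s≤s; _+_; _≤_; _<_; _⊓_; _∸_; _≤?_; _<?_; _<ᵇ_)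
import Data.Nat.Properties as ℕP
import Data.Nat.Tactic.RingSolver as ℕSolver
open import Data.Integer as ℤ using (ℤ; +_; -[1+_]; +≤+; _-_; ∣_∣)
import Data.Integer.Properties as ℤP
import Data.Integer.Tactic.RingSolver as ℤSolver
open import Data.Fin using (Fin; toℕ; fromℕ<)
import Data.Fin.Properties as FinP
open import Data.Bool using (true; false; if_then_else_; _∧_)
open import Data.Empty using (⊥; ⊥-elim)
open import Data.Unit using (⊤; tt)
open import Data.Sum using (_⊎_; inj₁; inj₂)
open import Data.Product using (_×_; _,_; Σ; ∃; proj₁; proj₂)
open import Data.List
  using (List; []; _∷_; map; filter; upTo; applyUpTo; _++_; length; reverse; zipWith; replicate)
import Data.List.Properties as ListP
open import Data.List.Relation.Unary.All using (All; []; _∷_)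
import Data.List.Relation.Unary.All.Properties as AllP
open import Data.List.Relation.Unary.Any using (here; there)
open import Data.List.Relation.Unary.Unique.Propositional using (Unique)
open import Data.List.Membership.Propositional using (_∈_)
open import Data.List.Membership.Propositional.Properties using (∈-map⁻; ∈-map⁺)
open import Data.List.Membership.DecPropositional ℕ._≟_ using (_∈?_)
open import Function.Bundles using (_⇔_; Equivalence)
open import Relation.Binary.PropositionalEquality
open import Relation.Nullary using (¬_; Dec; yes; no; does; ¬?)
open import Relation.Nullary.Decidable using (_×-dec_)
open import Relation.Unary using (Decidable)

sumR-cong< : ∀ m {f g : ℕ → ℤ} → (∀ k → k < m → f (suc k) ≡ g (suc k)) →
             sumR m f ≡ sumR m g
sumR-cong< zero    e = refl
sumR-cong< (suc m) e =
  cong₂ ℤ._+_ (sumR-cong< m (λ k k<m → e k (ℕP.m≤n⇒m≤1+n k<m))) (e m ℕP.≤-refl)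

sumR-cong : ∀ m {f g : ℕ → ℤ} → (∀ k → f (suc k) ≡ g (suc k)) → sumR m f ≡ sumR m g
sumR-cong m e = sumR-cong< m (λ k _ → e k)

sumR-zero : ∀ m {f : ℕ → ℤ} → (∀ k → k < m → f (suc k) ≡ + 0) → sumR m f ≡ + 0
sumR-zero zero    e = refl
sumR-zero (suc m) e = cong₂ ℤ._+_ (sumR-zero m (λ k k<m → e k (ℕP.m≤n⇒m≤1+n k<m))) (e m ℕP.≤-refl)

sumR-+ : ∀ m (f g : ℕ → ℤ) → sumR m (λ k → f k ℤ.+ g k) ≡ sumR m f ℤ.+ sumR m g
sumR-+ zero    f g = refl
sumR-+ (suc m) f g rewrite sumR-+ m f g = interchange (sumR m f) (sumR m g) (f (suc m)) (g (suc m))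
  where
  interchange : ∀ a b c d → (a ℤ.+ b) ℤ.+ (c ℤ.+ d) ≡ (a ℤ.+ c) ℤ.+ (b ℤ.+ d)
  interchange = ℤSolver.solve-∀

sumR-*ˡ : ∀ m c (f : ℕ → ℤ) → sumR m (λ k → c ℤ.* f k) ≡ c ℤ.* sumR m f
sumR-*ˡ zero    c f = sym (ℤP.*-zeroʳ c)
sumR-*ˡ (suc m) c f rewrite sumR-*ˡ m c f = sym (ℤP.*-distribˡ-+ c (sumR m f) (f (suc m)))

sumR-head : ∀ m (f : ℕ → ℤ) → sumR (suc m) f ≡ f 1 ℤ.+ sumR m (λ k → f (suc k))
sumR-head zero    f = ℤP.+-comm (+ 0) (f 1)
sumR-head (suc m) f rewrite sumR-head m f =
  ℤP.+-assoc (f 1) (sumR m (λ k → f (suc k))) (f (suc (suc m)))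

sumF≡sumR : ∀ n (f : Fin n → ℤ) (g : ℕ → ℤ) → (∀ l → g (suc (toℕ l)) ≡ f l) →
            sumF f ≡ sumR n g
sumF≡sumR zero    f g e = refl
sumF≡sumR (suc n) f g e = begin
  f Data.Fin.zero ℤ.+ sumF (λ k → f (Data.Fin.suc k))
    ≡⟨ cong₂ ℤ._+_ (sym (e Data.Fin.zero))
                   (sumF≡sumR n _ (λ k → g (suc k)) (λ l → e (Data.Fin.suc l))) ⟩
  g 1 ℤ.+ sumR n (λ k → g (suc k))
    ≡⟨ sym (sumR-head n g) ⟩
  sumR (suc n) g ∎
  where open ≡-Reasoning

sumR-beyond : ∀ m d (f : ℕ → ℤ) → (∀ k → m < k → f k ≡ + 0) → sumR (d + m) f ≡ sumR m f
sumR-beyond m zero    f e = refl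
sumR-beyond m (suc d) f e
  rewrite sumR-beyond m d f e | e (suc (d + m)) (s≤s (ℕP.m≤n+m m d)) = ℤP.+-identityʳ _

sumℕ : ℕ → (ℕ → ℕ) → ℕ
sumℕ zero    f = 0
sumℕ (suc m) f = sumℕ m f + f (suc m)

sumR-ℕ : ∀ m (f : ℕ → ℕ) → sumR m (λ k → + f k) ≡ + sumℕ m f
sumR-ℕ zero    f = refl
sumR-ℕ (suc m) f rewrite sumR-ℕ m f = refl

sumℕ-cong : ∀ m {f g : ℕ → ℕ} → (∀ k → f (suc k) ≡ g (suc k)) → sumℕ m f ≡ sumℕ m g
sumℕ-cong zero    e = refl
sumℕ-cong (suc m) e = cong₂ _+_ (sumℕ-cong m e) (e m)

sumℕ-zero : ∀ m {f : ℕ → ℕ} → (∀ k → f (suc k) ≡ 0) → sumℕ m f ≡ 0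
sumℕ-zero zero    e = refl
sumℕ-zero (suc m) e = cong₂ _+_ (sumℕ-zero m e) (e m)

sumℕ-head : ∀ m (f : ℕ → ℕ) → sumℕ (suc m) f ≡ f 1 + sumℕ m (λ k → f (suc k))
sumℕ-head zero    f = ℕP.+-comm 0 (f 1)
sumℕ-head (suc m) f rewrite sumℕ-head m f = ℕP.+-assoc (f 1) (sumℕ m (λ k → f (suc k))) (f (suc (suc m)))

x+y≡x : ∀ x {y} → y ≡ 0 → x + y ≡ x
x+y≡x x refl = ℕP.+-identityʳ x

module Access {n : ℕ} (A : Mat n) where

  at-inside : ∀ i j (p : i < n) (q : j < n) → at A (suc i) (suc j) ≡ A (fromℕ< p) (fromℕ< q)
  at-inside i j p q with i <? n | j <? n
  ... | yes _ | yes _ = refl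
  ... | no ¬p | _     = ⊥-elim (¬p p)
  ... | yes _ | no ¬q = ⊥-elim (¬q q)

  at-fin : ∀ (i j : Fin n) → at A (suc (toℕ i)) (suc (toℕ j)) ≡ A i j
  at-fin i j = trans (at-inside _ _ (FinP.toℕ<n i) (FinP.toℕ<n j))
                     (cong₂ A (FinP.fromℕ<-toℕ i _) (FinP.fromℕ<-toℕ j _))

  at-row-outside : ∀ i j → n < i → at A i j ≡ + 0
  at-row-outside zero    j       _ = refl
  at-row-outside (suc i) zero    _ = refl
  at-row-outside (suc i) (suc j) n<i with i <? n | j <? n
  ... | yes p | yes _ = ⊥-elim (ℕP.<-irrefl refl (ℕP.<-≤-trans p (ℕ.s≤s⁻¹ n<i)))
  ... | yes _ | no _  = refl
  ... | no _  | _     = refl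

  at-col-outside : ∀ i j → n < j → at A i j ≡ + 0
  at-col-outside zero    j       _ = refl
  at-col-outside (suc i) zero    _ = refl
  at-col-outside (suc i) (suc j) n<j with i <? n | j <? n
  ... | yes _ | yes q = ⊥-elim (ℕP.<-irrefl refl (ℕP.<-≤-trans q (ℕ.s≤s⁻¹ n<j)))
  ... | yes _ | no _  = refl
  ... | no _  | _     = refl

  at-col-zero : ∀ i → at A i 0 ≡ + 0
  at-col-zero zero    = refl
  at-col-zero (suc i) = refl

-- Then every prefix sum is 0 or 1.
-- A prefix is "consistent" if its sum is 1 and its last nonzero entry is 1,
-- or its sum is 0 and its last nonzero entry (if any) is -1; otherwise it is
-- "offset" (sum -1 after a -1, or sum 0 after a 1).  Consistency is lost only
-- towards an offset state, offset states are never left, and an offset prefix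
-- cannot have sum 1, so every prefix is consistent.
module AlternatingPrefix (x : ℕ → ℤ)
  (entry : ∀ k → (x k ≡ + 0) ⊎ ((x k ≡ + 1) ⊎ (x k ≡ ℤ.- + 1)))
  (alternate : ∀ l l' → 1 ≤ l → l < l' → x l ≢ + 0 → x l' ≢ + 0 →
               (∀ q → l < q → q < l' → x q ≡ + 0) → x l' ≡ ℤ.- x l)
  (m : ℕ) (total : sumR m x ≡ + 1) (beyond : ∀ k → m < k → x k ≡ + 0) where

  S : ℕ → ℤ
  S j = sumR j x

  AllZero : ℕ → Set
  AllZero j = ∀ q → 1 ≤ q → q ≤ j → x q ≡ + 0

  LastNonzero : ℕ → ℤ → Set
  LastNonzero j v = Σ ℕ λ l → (1 ≤ l) × (l ≤ j) × (x l ≡ v) × (∀ q → l < q → q ≤ j → x q ≡ + 0)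

  Consistent Offset : ℕ → Set
  Consistent j = ((S j ≡ + 1) × LastNonzero j (+ 1))
               ⊎ ((S j ≡ + 0) × (AllZero j ⊎ LastNonzero j -[1+ 0 ]))
  Offset j     = ((S j ≡ -[1+ 0 ]) × LastNonzero j -[1+ 0 ])
               ⊎ ((S j ≡ + 0) × LastNonzero j (+ 1))

  lastNonzero-skip : ∀ {j v} → LastNonzero j v → x (suc j) ≡ + 0 → LastNonzero (suc j) v
  lastNonzero-skip {j} (l , 1≤l , l≤j , xl , after) z =
    l , 1≤l , ℕP.m≤n⇒m≤1+n l≤j , xl , after′
    where
    after′ : ∀ q → l < q → q ≤ suc j → x q ≡ + 0
    after′ q l<q q≤ with ℕP.m≤n⇒m<n∨m≡n q≤
    ... | inj₁ q<  = after q l<q (ℕ.s≤s⁻¹ q<)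
    ... | inj₂ refl = z

  allZero-skip : ∀ {j} → AllZero j → x (suc j) ≡ + 0 → AllZero (suc j)
  allZero-skip h z q 1≤q q≤ with ℕP.m≤n⇒m<n∨m≡n q≤
  ... | inj₁ q<   = h q 1≤q (ℕ.s≤s⁻¹ q<)
  ... | inj₂ refl = z

  lastNonzero-here : ∀ {j v} → x (suc j) ≡ v → LastNonzero (suc j) v
  lastNonzero-here e = _ , s≤s z≤n , ℕP.≤-refl , e , λ q lt le → ⊥-elim (ℕP.<-irrefl refl (ℕP.<-≤-trans lt le))

  next-opposite : ∀ {j u v} → LastNonzero j u → u ≢ + 0 → x (suc j) ≡ v → v ≢ + 0 → v ≡ ℤ.- u
  next-opposite {j} (l , 1≤l , l≤j , xl , after) u≢0 xv v≢0 =
    trans (sym xv) (trans (alternate l (suc j) 1≤l (s≤s l≤j) (λ e → u≢0 (trans (sym xl) e))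
                              (λ e → v≢0 (trans (sym xv) e)) (λ q lt lt′ → after q lt (ℕ.s≤s⁻¹ lt′)))
                          (cong ℤ.-_ xl))

  offset-step : ∀ {j} → Offset j → Offset (suc j)
  offset-step {j} o with entry (suc j)
  offset-step (inj₁ (s , ln)) | inj₁ z rewrite s | z = inj₁ (refl , lastNonzero-skip ln z)
  offset-step (inj₂ (s , ln)) | inj₁ z rewrite s | z = inj₂ (refl , lastNonzero-skip ln z)
  offset-step (inj₁ (s , ln)) | inj₂ (inj₁ o) rewrite s | o = inj₂ (refl , lastNonzero-here o)
  offset-step (inj₂ (s , ln)) | inj₂ (inj₁ o) with next-opposite ln (λ ()) o (λ ())
  ... | ()
  offset-step (inj₁ (s , ln)) | inj₂ (inj₂ o) with next-opposite ln (λ ()) o (λ ())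
  ... | ()
  offset-step (inj₂ (s , ln)) | inj₂ (inj₂ o) rewrite s | o = inj₁ (refl , lastNonzero-here o)

  consistent-step : ∀ {j} → Consistent j → Consistent (suc j) ⊎ Offset (suc j)
  consistent-step {j} c with entry (suc j)
  consistent-step (inj₁ (s , ln)) | inj₁ z rewrite s | z =
    inj₁ (inj₁ (refl , lastNonzero-skip ln z))
  consistent-step (inj₂ (s , inj₁ az)) | inj₁ z rewrite s | z =
    inj₁ (inj₂ (refl , inj₁ (allZero-skip az z)))
  consistent-step (inj₂ (s , inj₂ ln)) | inj₁ z rewrite s | z =
    inj₁ (inj₂ (refl , inj₂ (lastNonzero-skip ln z)))
  consistent-step (inj₁ (s , ln)) | inj₂ (inj₁ o) with next-opposite ln (λ ()) o (λ ())
  ... | ()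
  consistent-step (inj₂ (s , inj₁ _)) | inj₂ (inj₁ o) rewrite s | o =
    inj₁ (inj₁ (refl , lastNonzero-here o))
  consistent-step (inj₂ (s , inj₂ _)) | inj₂ (inj₁ o) rewrite s | o =
    inj₁ (inj₁ (refl , lastNonzero-here o))
  consistent-step (inj₁ (s , _)) | inj₂ (inj₂ o) rewrite s | o =
    inj₁ (inj₂ (refl , inj₂ (lastNonzero-here o)))
  consistent-step (inj₂ (s , inj₁ _)) | inj₂ (inj₂ o) rewrite s | o =
    inj₂ (inj₁ (refl , lastNonzero-here o))
  consistent-step (inj₂ (s , inj₂ ln)) | inj₂ (inj₂ o) with next-opposite ln (λ ()) o (λ ())
  ... | ()

  every-prefix : ∀ j → Consistent j ⊎ Offset j
  every-prefix zero = inj₁ (inj₂ (refl , inj₁ (λ q 1≤q q≤0 → ⊥-elim (ℕP.<-irrefl refl (ℕP.<-≤-trans 1≤q q≤0)))))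
  every-prefix (suc j) with every-prefix j
  ... | inj₁ c = consistent-step c
  ... | inj₂ o = inj₂ (offset-step o)

  offset-forever : ∀ {j} → Offset j → ∀ d → Offset (d + j)
  offset-forever o zero    = o
  offset-forever o (suc d) = offset-step (offset-forever o d)

  offset-sum≢1 : ∀ {j} → Offset j → S j ≢ + 1
  offset-sum≢1 (inj₁ (s , _)) e with trans (sym s) e
  ... | ()
  offset-sum≢1 (inj₂ (s , _)) e with trans (sym s) e
  ... | ()

  prefix-sum : ∀ j → (S j ≡ + 0) ⊎ (S j ≡ + 1)
  prefix-sum j with every-prefix j
  ... | inj₁ (inj₁ (s , _)) = inj₂ s
  ... | inj₁ (inj₂ (s , _)) = inj₁ s
  ... | inj₂ o = ⊥-elim (offset-sum≢1 (offset-forever o m) eventually-total)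
    where
    eventually-total : S (m + j) ≡ + 1
    eventually-total = trans (cong S (ℕP.+-comm m j)) (trans (sumR-beyond m j x beyond) total)

transpose : ∀ {n} → Mat n → Mat n
transpose A i j = A j i

transpose-ASM : ∀ {n} (A : Mat n) → IsASM A → IsASM (transpose A)
transpose-ASM A asm = record
  { entries = λ i j → IsASM.entries asm j i
  ; rowSum  = IsASM.colSum asm
  ; colSum  = IsASM.rowSum asm
  ; rowAlt  = IsASM.colAlt asm
  ; colAlt  = IsASM.rowAlt asm
  }

at-transpose : ∀ {n} (A : Mat n) k l → at (transpose A) k l ≡ at A l k
at-transpose A zero    l       = sym (Access.at-col-zero A l)
at-transpose A (suc k) zero    = refl
at-transpose {n} A (suc i) (suc j) = by-range (i <? n) (j <? n)
  where
  open Access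
  by-range : Dec (i < n) → Dec (j < n) → at (transpose A) (suc i) (suc j) ≡ at A (suc j) (suc i)
  by-range (yes p) (yes q) = trans (at-inside (transpose A) i j p q) (sym (at-inside A j i q p))
  by-range (no ¬p) _       = trans (at-row-outside (transpose A) (suc i) (suc j) (s≤s (ℕP.≮⇒≥ ¬p)))
                                   (sym (at-col-outside A (suc j) (suc i) (s≤s (ℕP.≮⇒≥ ¬p))))
  by-range (yes _) (no ¬q) = trans (at-col-outside (transpose A) (suc i) (suc j) (s≤s (ℕP.≮⇒≥ ¬q)))
                                   (sym (at-row-outside A (suc j) (suc i) (s≤s (ℕP.≮⇒≥ ¬q))))

module RowPrefix {n : ℕ} (A : Mat n) (asm : IsASM A) where
  open Access A

  rowPrefix : ℕ → ℕ → ℤ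
  rowPrefix k j = sumR j (λ l → at A k l)

  rowPrefix-total : ∀ k (k<n : k < n) → rowPrefix (suc k) n ≡ + 1
  rowPrefix-total k k<n =
    trans (sym (sumF≡sumR n (λ l → A (fromℕ< k<n) l) (at A (suc k))
                  (λ l → trans (at-inside k (toℕ l) k<n (FinP.toℕ<n l))
                               (cong (A (fromℕ< k<n)) (FinP.fromℕ<-toℕ l _)))))
          (IsASM.rowSum asm (fromℕ< k<n))

  nonzero-inside : ∀ k l → at A (suc k) l ≢ + 0 → Σ ℕ λ l′ → (l ≡ suc l′) × (l′ < n)
  nonzero-inside k zero    nz = ⊥-elim (nz refl)
  nonzero-inside k (suc l) nz = by-range (l <? n)
    where
    by-range : Dec (l < n) → Σ ℕ λ l′ → (suc l ≡ suc l′) × (l′ < n)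
    by-range (yes l<n) = l , refl , l<n
    by-range (no l≮n)  = ⊥-elim (nz (at-col-outside (suc k) (suc l) (s≤s (ℕP.≮⇒≥ l≮n))))

  module _ (k : ℕ) (k<n : k < n) where
    private
      row : ℕ → ℤ
      row = at A (suc k)

      atRow : ∀ {l} (l<n : l < n) → row (suc l) ≡ A (fromℕ< k<n) (fromℕ< l<n)
      atRow {l} l<n = at-inside k l k<n l<n

    row-entry : ∀ l → (row l ≡ + 0) ⊎ ((row l ≡ + 1) ⊎ (row l ≡ ℤ.- + 1))
    row-entry zero    = inj₁ refl
    row-entry (suc l) = by-range (l <? n)
      where
      by-range : Dec (l < n) → (row (suc l) ≡ + 0) ⊎ ((row (suc l) ≡ + 1) ⊎ (row (suc l) ≡ ℤ.- + 1))
      by-range (yes l<n) rewrite atRow l<n = IsASM.entries asm (fromℕ< k<n) (fromℕ< l<n)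
      by-range (no l≮n)  = inj₁ (at-col-outside (suc k) (suc l) (s≤s (ℕP.≮⇒≥ l≮n)))

    row-alternates : ∀ l l′ → 1 ≤ l → l < l′ → row l ≢ + 0 → row l′ ≢ + 0 →
                     (∀ q → l < q → q < l′ → row q ≡ + 0) → row l′ ≡ ℤ.- row l
    row-alternates l l′ _ l<l′ nz nz′ between
      with nonzero-inside k l nz | nonzero-inside k l′ nz′
    ... | a , refl , a<n | b , refl , b<n =
      trans (atRow b<n)
        (trans (IsASM.rowAlt asm (fromℕ< k<n) (fromℕ< a<n) (fromℕ< b<n)
                  (subst₂ _<_ (sym (FinP.toℕ-fromℕ< a<n)) (sym (FinP.toℕ-fromℕ< b<n)) (ℕ.s≤s⁻¹ l<l′))
                  (λ e → nz (trans (atRow a<n) e)) (λ e → nz′ (trans (atRow b<n) e))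
                  between-fin)
               (cong ℤ.-_ (sym (atRow a<n))))
      where
      between-fin : ∀ f → toℕ (fromℕ< a<n) < toℕ f → toℕ f < toℕ (fromℕ< b<n) →
                    A (fromℕ< k<n) f ≡ + 0
      between-fin f a<f f<b =
        trans (sym (trans (atRow (FinP.toℕ<n f)) (cong (A (fromℕ< k<n)) (FinP.fromℕ<-toℕ f _))))
              (between (suc (toℕ f)) (s≤s (subst (_< toℕ f) (FinP.toℕ-fromℕ< a<n) a<f))
                                     (s≤s (subst (toℕ f <_) (FinP.toℕ-fromℕ< b<n) f<b)))

  rowPrefix-bit : ∀ k j → (rowPrefix k j ≡ + 0) ⊎ (rowPrefix k j ≡ + 1)
  rowPrefix-bit zero    j = inj₁ (sumR-zero j (λ l _ → refl))
  rowPrefix-bit (suc k) j with k <? n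
  ... | no k≮n  = inj₁ (sumR-zero j (λ l _ → at-row-outside (suc k) (suc l) (s≤s (ℕP.≮⇒≥ k≮n))))
  ... | yes k<n = AlternatingPrefix.prefix-sum (at A (suc k)) (row-entry k k<n) (row-alternates k k<n)
                    n (rowPrefix-total k k<n) (λ l n<l → at-col-outside (suc k) l n<l) j

module UnitSteps (f δ : ℕ → ℕ) (step : ∀ k → f (suc k) ≡ f k + δ k) (δ≤1 : ∀ k → δ k ≤ 1) where

  private
    monotone : ∀ d k → f k ≤ f (d + k)
    monotone zero    k = ℕP.≤-refl
    monotone (suc d) k = ℕP.≤-trans (monotone d k)
                           (ℕP.≤-trans (ℕP.m≤m+n _ _) (ℕP.≤-reflexive (sym (step (d + k)))))

    lipschitz : ∀ d k → f (d + k) ≤ f k + d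
    lipschitz zero    k = ℕP.≤-reflexive (sym (ℕP.+-identityʳ _))
    lipschitz (suc d) k = begin
      f (suc (d + k))     ≡⟨ step (d + k) ⟩
      f (d + k) + δ (d + k) ≤⟨ ℕP.+-mono-≤ (lipschitz d k) (δ≤1 (d + k)) ⟩
      f k + d + 1         ≡⟨ ℕP.+-assoc (f k) d 1 ⟩
      f k + (d + 1)       ≡⟨ cong (λ t → f k + t) (ℕP.+-comm d 1) ⟩
      f k + suc d         ∎
      where open ℕP.≤-Reasoning

  bounded-by-distance : ∀ x y → f x ≤ f y + (x ∸ y)
  bounded-by-distance x y with ℕP.≤-total x y
  ... | inj₁ x≤y = ℕP.≤-trans (subst (λ t → f x ≤ f t) (ℕP.m∸n+n≡m x≤y) (monotone (y ∸ x) x))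
                              (ℕP.m≤m+n _ _)
  ... | inj₂ y≤x = subst (λ t → f t ≤ f y + (x ∸ y)) (ℕP.m∸n+n≡m y≤x) (lipschitz (x ∸ y) y)

module CornerSum {n : ℕ} (A : Mat n) (asm : IsASM A) where
  open Access A
  open RowPrefix A asm public
  private
    module Tr = RowPrefix (transpose A) (transpose-ASM A asm)

  colPrefix : ℕ → ℕ → ℤ
  colPrefix i l = sumR i (λ k → at A k l)

  colPrefix≡ : ∀ i l → colPrefix i l ≡ Tr.rowPrefix l i
  colPrefix≡ i l = sumR-cong i (λ k → sym (at-transpose A l (suc k)))

  colPrefix-total : ∀ l (l<n : l < n) → colPrefix n (suc l) ≡ + 1
  colPrefix-total l l<n = trans (colPrefix≡ n (suc l)) (Tr.rowPrefix-total l l<n)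

  colPrefix-bit : ∀ i l → (colPrefix i l ≡ + 0) ⊎ (colPrefix i l ≡ + 1)
  colPrefix-bit i l rewrite colPrefix≡ i l = Tr.rowPrefix-bit l i

  private
    as-bit : ∀ (z : ℤ) → (z ≡ + 0) ⊎ (z ≡ + 1) → (z ≡ + ∣ z ∣) × (∣ z ∣ ≤ 1)
    as-bit z (inj₁ refl) = refl , z≤n
    as-bit z (inj₂ refl) = refl , s≤s z≤n

  rowBit colBit : ℕ → ℕ → ℕ
  rowBit k j = ∣ rowPrefix k j ∣
  colBit i l = ∣ colPrefix i l ∣

  rowBit≡ : ∀ k j → rowPrefix k j ≡ + rowBit k j
  rowBit≡ k j = proj₁ (as-bit _ (rowPrefix-bit k j))

  colBit≡ : ∀ i l → colPrefix i l ≡ + colBit i l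
  colBit≡ i l = proj₁ (as-bit _ (colPrefix-bit i l))

  rowBit≤1 : ∀ k j → rowBit k j ≤ 1
  rowBit≤1 k j = proj₂ (as-bit _ (rowPrefix-bit k j))

  colBit≤1 : ∀ i l → colBit i l ≤ 1
  colBit≤1 i l = proj₂ (as-bit _ (colPrefix-bit i l))

  rk : ℕ → ℕ → ℕ
  rk i j = sumℕ i (λ k → rowBit k j)

  r≡rk : ∀ i j → r A i j ≡ + rk i j
  r≡rk i j = trans (sumR-cong i (λ k → rowBit≡ (suc k) j)) (sumR-ℕ i (λ k → rowBit k j))

  rk-col-step : ∀ i j → rk i (suc j) ≡ rk i j + colBit i (suc j)
  rk-col-step i j = ℤP.+-injective (begin
    + rk i (suc j)                     ≡⟨ sym (r≡rk i (suc j)) ⟩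
    r A i (suc j)                      ≡⟨ sumR-+ i (λ k → rowPrefix k j) (λ k → at A k (suc j)) ⟩
    r A i j ℤ.+ colPrefix i (suc j)    ≡⟨ cong₂ ℤ._+_ (r≡rk i j) (colBit≡ i (suc j)) ⟩
    + (rk i j + colBit i (suc j))      ∎)
    where open ≡-Reasoning

  rk-col-zero : ∀ i → rk i 0 ≡ 0
  rk-col-zero i = sumℕ-zero i (λ k → refl)

  rk-row-Lipschitz : ∀ x y b → rk x b ≤ rk y b + (x ∸ y)
  rk-row-Lipschitz x y b =
    UnitSteps.bounded-by-distance (λ i → rk i b) (λ k → rowBit (suc k) b) (λ k → refl)
                                  (λ k → rowBit≤1 (suc k) b) x y

  rk-col-Lipschitz : ∀ a x y → rk a x ≤ rk a y + (x ∸ y)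
  rk-col-Lipschitz a =
    UnitSteps.bounded-by-distance (rk a) (λ k → colBit a (suc k)) (rk-col-step a)
                                  (λ k → colBit≤1 a (suc k))

  rk≤row : ∀ i j → rk i j ≤ i
  rk≤row i j = rk-row-Lipschitz i 0 j

  rk≤col : ∀ i j → rk i j ≤ j
  rk≤col i j = subst (λ t → rk i j ≤ t + (j ∸ 0)) (rk-col-zero i) (rk-col-Lipschitz i j 0)

  rk-full-width : ∀ i → i ≤ n → rk i n ≡ i
  rk-full-width zero    _   = refl
  rk-full-width (suc i) i<n rewrite rk-full-width i (ℕP.<⇒≤ i<n) | rowPrefix-total i i<n = ℕP.+-comm i 1

  -- columns j+1..n hold at most n - j of the first i rows' total
  rk-lower : ∀ i j → i ≤ n → j ≤ n → i + j ≤ rk i j + n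
  rk-lower i j i≤n j≤n = begin
    i + j                  ≡⟨ cong (_+ j) (sym (rk-full-width i i≤n)) ⟩
    rk i n + j             ≤⟨ ℕP.+-monoˡ-≤ j (rk-col-Lipschitz i n j) ⟩
    rk i j + (n ∸ j) + j   ≡⟨ ℕP.+-assoc (rk i j) (n ∸ j) j ⟩
    rk i j + (n ∸ j + j)   ≡⟨ cong (λ t → rk i j + t) (ℕP.m∸n+n≡m j≤n) ⟩
    rk i j + n             ∎
    where open ℕP.≤-Reasoning

cut : ℕ → (ℕ → ℤ) → ℕ → ℤ
cut j f l = if j <ᵇ l then f l else + 0

cut-above : ∀ j l (f : ℕ → ℤ) → j < l → cut j f l ≡ f l
cut-above j l f j<l with j <ᵇ l | ℕP.<⇒<ᵇ j<l
... | true | _ = refl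

cut-below : ∀ j l (f : ℕ → ℤ) → l ≤ j → cut j f l ≡ + 0
cut-below j l f l≤j with j <ᵇ l | ℕP.<ᵇ⇒< j l
... | false | _    = refl
... | true  | j<l = ⊥-elim (ℕP.<-irrefl refl (ℕP.<-≤-trans (j<l _) l≤j))

sumR-split : ∀ j m (f : ℕ → ℤ) → j ≤ m → sumR j f ℤ.+ sumR m (cut j f) ≡ sumR m f
sumR-split j zero    f z≤n = refl
sumR-split j (suc m) f j≤ with ℕP.m≤n⇒m<n∨m≡n j≤
... | inj₂ refl = trans (cong (λ t → sumR (suc m) f ℤ.+ t) nothing-left) (ℤP.+-identityʳ _)
  where
  nothing-left : sumR (suc m) (cut (suc m) f) ≡ + 0
  nothing-left = sumR-zero (suc m) (λ l l<m → cut-below (suc m) (suc l) f l<m)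
... | inj₁ j<sm = begin
  sumR j f ℤ.+ (sumR m (cut j f) ℤ.+ cut j f (suc m))
    ≡⟨ sym (ℤP.+-assoc (sumR j f) _ _) ⟩
  (sumR j f ℤ.+ sumR m (cut j f)) ℤ.+ cut j f (suc m)
    ≡⟨ cong₂ ℤ._+_ (sumR-split j m f (ℕ.s≤s⁻¹ j<sm)) (cut-above j (suc m) f j<sm) ⟩
  sumR m f ℤ.+ f (suc m) ∎
  where open ≡-Reasoning

-- Indeed the defining double sum factors as (1 - rowPrefix) (1 - colPrefix).
module Diagram {n : ℕ} (A : Mat n) (asm : IsASM A) where
  open CornerSum A asm

  InDiagram : ℕ → ℕ → Set
  InDiagram i j = (1 ≤ i) × (i ≤ n) × (1 ≤ j) × (j ≤ n) × (rowBit i j ≡ 0) × (colBit i j ≡ 0)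

  private
    if-∧ : ∀ b c (x y : ℤ) →
           (if b ∧ c then x ℤ.* y else + 0) ≡ (if c then x else + 0) ℤ.* (if b then y else + 0)
    if-∧ true  true  x y = refl
    if-∧ true  false x y = refl
    if-∧ false true  x y = sym (ℤP.*-zeroʳ x)
    if-∧ false false x y = refl

    sum-product : ∀ m (X Y : ℕ → ℤ) → sumR m (λ k → sumR m (λ l → X l ℤ.* Y k)) ≡ sumR m X ℤ.* sumR m Y
    sum-product m X Y = trans (sumR-cong m (λ k → trans (sumR-cong m (λ l → ℤP.*-comm (X (suc l)) (Y (suc k))))
                                                 (trans (sumR-*ˡ m (Y (suc k)) X) (ℤP.*-comm (Y (suc k)) (sumR m X)))))
                              (sumR-*ˡ m (sumR m X) Y)

    beyond≡ : ∀ j (f : ℕ → ℤ) → j ≤ n → sumR n f ≡ + 1 → sumR j f ≡ + ∣ sumR j f ∣ →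
              sumR n (cut j f) ≡ + 1 - + ∣ sumR j f ∣
    beyond≡ j f j≤n total prefix = begin
      sumR n (cut j f)                              ≡⟨ sym (ℤP.+-identityʳ _) ⟩
      sumR n (cut j f) ℤ.+ + 0                      ≡⟨ cong (λ t → sumR n (cut j f) ℤ.+ t) (sym (ℤP.+-inverseʳ (sumR j f))) ⟩
      sumR n (cut j f) ℤ.+ (sumR j f - sumR j f)    ≡⟨ sym (ℤP.+-assoc (sumR n (cut j f)) _ _) ⟩
      (sumR n (cut j f) ℤ.+ sumR j f) - sumR j f    ≡⟨ cong (_- sumR j f) (trans (ℤP.+-comm (sumR n (cut j f)) (sumR j f)) (sumR-split j n f j≤n)) ⟩
      sumR n f - sumR j f                           ≡⟨ cong₂ _-_ total prefix ⟩
      + 1 - + ∣ sumR j f ∣                          ∎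
      where open ≡-Reasoning

  inversion-sum : ∀ i j → 1 ≤ i → i ≤ n → 1 ≤ j → j ≤ n →
    sumR n (λ k → sumR n (λ l → if (i <ᵇ k) ∧ (j <ᵇ l) then at A i l ℤ.* at A k j else + 0))
      ≡ (+ 1 - + rowBit i j) ℤ.* (+ 1 - + colBit i j)
  inversion-sum (suc i′) (suc j′) _ i≤n _ j≤n = begin
    sumR n (λ k → sumR n (λ l → if (i <ᵇ k) ∧ (j <ᵇ l) then at A i l ℤ.* at A k j else + 0))
      ≡⟨ sumR-cong n (λ k → sumR-cong n (λ l → if-∧ (i <ᵇ suc k) (j <ᵇ suc l) (at A i (suc l)) (at A (suc k) j))) ⟩
    sumR n (λ k → sumR n (λ l → cut j (at A i) l ℤ.* cut i (λ k → at A k j) k))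
      ≡⟨ sum-product n (cut j (at A i)) (cut i (λ k → at A k j)) ⟩
    sumR n (cut j (at A i)) ℤ.* sumR n (cut i (λ k → at A k j))
      ≡⟨ cong₂ ℤ._*_ (beyond≡ j (at A i) j≤n (rowPrefix-total i′ i≤n) (rowBit≡ i j))
                     (beyond≡ i (λ k → at A k j) i≤n (colPrefix-total j′ j≤n) (colBit≡ i j)) ⟩
    (+ 1 - + rowBit i j) ℤ.* (+ 1 - + colBit i j) ∎
    where
    open ≡-Reasoning
    i = suc i′
    j = suc j′

  private
    both-zero : ∀ a b → a ≤ 1 → b ≤ 1 → (+ 1 - + a) ℤ.* (+ 1 - + b) ≡ + 1 → (a ≡ 0) × (b ≡ 0)
    both-zero zero          zero          _ _ _  = refl , refl
    both-zero zero          (suc zero)    _ _ ()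
    both-zero (suc zero)    zero          _ _ ()
    both-zero (suc zero)    (suc zero)    _ _ ()
    both-zero zero          (suc (suc b)) _ (s≤s ()) _
    both-zero (suc (suc a)) _             (s≤s ()) _ _

  InD→InDiagram : ∀ i j → InD A i j → InDiagram i j
  InD→InDiagram i j (1≤i , i≤n , 1≤j , j≤n , one)
    with both-zero (rowBit i j) (colBit i j) (rowBit≤1 i j) (colBit≤1 i j)
                   (trans (sym (inversion-sum i j 1≤i i≤n 1≤j j≤n)) one)
  ... | row0 , col0 = 1≤i , i≤n , 1≤j , j≤n , row0 , col0

  InDiagram→InD : ∀ i j → InDiagram i j → InD A i j
  InDiagram→InD i j (1≤i , i≤n , 1≤j , j≤n , row0 , col0) =
    1≤i , i≤n , 1≤j , j≤n ,
    trans (inversion-sum i j 1≤i i≤n 1≤j j≤n)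
          (cong₂ (λ u v → (+ 1 - + u) ℤ.* (+ 1 - + v)) row0 col0)

-- Starting from a cell of the diagram and moving down or
-- right while staying in the diagram, the rank r_A does not change (the
-- partial sums crossed are 0); the walk ends at an essential cell.  Starting
-- from a cell (a,b) with r_A(a,b) < min(a,b) and moving up or left across
-- partial sums equal to 1 keeps  r_A(i,j) + (a - i) + (b - j)  constant and
-- must stop at a diagram cell before reaching row or column 0.
module EssentialWitness {n : ℕ} (A : Mat n) (asm : IsASM A) where
  open CornerSum A asm
  open Diagram A asm

  InDiagram? : ∀ i j → Dec (InDiagram i j)
  InDiagram? i j = (1 ≤? i) ×-dec (i ≤? n) ×-dec (1 ≤? j) ×-dec (j ≤? n)
                   ×-dec (rowBit i j ℕ.≟ 0) ×-dec (colBit i j ℕ.≟ 0)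

  essential-southeast : ∀ u v i j → u + i ≡ n → v + j ≡ n → InDiagram i j →
    Σ ℕ λ i′ → Σ ℕ λ j′ → Ess A i′ j′ × (i ≤ i′) × (j ≤ j′) × (rk i′ j′ ≡ rk i j)
  essential-southeast u v i j u+i v+j d with InDiagram? (suc i) j | InDiagram? i (suc j)
  ... | no ¬down | no ¬right =
    i , j , (InDiagram→InD i j d , (λ z → ¬down (InD→InDiagram _ _ z)) , (λ z → ¬right (InD→InDiagram _ _ z))) ,
    ℕP.≤-refl , ℕP.≤-refl , refl
  ... | yes down@(_ , i<n , _ , _ , row0 , _) | _ with u
  ...   | zero   = ⊥-elim (ℕP.<-irrefl u+i i<n)
  ...   | suc u′ with essential-southeast u′ v (suc i) j (trans (ℕP.+-suc u′ i) u+i) v+j down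
  ...     | i′ , j′ , e , i<i′ , j≤j′ , same =
    i′ , j′ , e , ℕP.<⇒≤ i<i′ , j≤j′ , trans same (x+y≡x (rk i j) row0)
  essential-southeast u v i j u+i v+j d
      | no _ | yes right@(_ , _ , _ , j<n , _ , col0) with v
  ...   | zero   = ⊥-elim (ℕP.<-irrefl v+j j<n)
  ...   | suc v′ with essential-southeast u v′ i (suc j) u+i (trans (ℕP.+-suc v′ j) v+j) right
  ...     | i′ , j′ , e , i≤i′ , j<j′ , same =
    i′ , j′ , e , i≤i′ , ℕP.<⇒≤ j<j′ ,
    trans same (trans (rk-col-step i j) (x+y≡x (rk i j) col0))

  private
    bit-one : ∀ x → x ≤ 1 → x ≢ 0 → x ≡ 1
    bit-one zero          _        x≢0 = ⊥-elim (x≢0 refl)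
    bit-one (suc zero)    _        _   = refl
    bit-one (suc (suc x)) (s≤s ()) _

    ∸-suc : ∀ a i → suc i ≤ a → a ∸ i ≡ suc (a ∸ suc i)
    ∸-suc a i le = ℕP.+-∸-assoc 1 le

    shift-one : ∀ r u v → r + 1 + u + v ≡ r + suc u + v
    shift-one = ℕSolver.solve-∀

    shift-one′ : ∀ r u v → r + 1 + u + v ≡ r + u + suc v
    shift-one′ = ℕSolver.solve-∀

  module _ (a b : ℕ) (a≤n : a ≤ n) (b≤n : b ≤ n) (deficient : rk a b < a ⊓ b) where

    potential : ℕ → ℕ → ℕ
    potential i j = rk i j + (a ∸ i) + (b ∸ j)

    potential-up : ∀ i j → suc i ≤ a → rowBit (suc i) j ≡ 1 → potential (suc i) j ≡ potential i j
    potential-up i j i<a bit = begin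
      rk i j + rowBit (suc i) j + (a ∸ suc i) + (b ∸ j) ≡⟨ cong (λ t → rk i j + t + (a ∸ suc i) + (b ∸ j)) bit ⟩
      rk i j + 1 + (a ∸ suc i) + (b ∸ j)                ≡⟨ shift-one (rk i j) (a ∸ suc i) (b ∸ j) ⟩
      rk i j + suc (a ∸ suc i) + (b ∸ j)                ≡⟨ cong (λ t → rk i j + t + (b ∸ j)) (sym (∸-suc a i i<a)) ⟩
      potential i j                                    ∎
      where open ≡-Reasoning

    potential-left : ∀ i j → suc j ≤ b → colBit i (suc j) ≡ 1 → potential i (suc j) ≡ potential i j
    potential-left i j j<b bit = begin
      rk i (suc j) + (a ∸ i) + (b ∸ suc j)              ≡⟨ cong (λ t → t + (a ∸ i) + (b ∸ suc j)) (rk-col-step i j) ⟩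
      rk i j + colBit i (suc j) + (a ∸ i) + (b ∸ suc j) ≡⟨ cong (λ t → rk i j + t + (a ∸ i) + (b ∸ suc j)) bit ⟩
      rk i j + 1 + (a ∸ i) + (b ∸ suc j)                ≡⟨ shift-one′ (rk i j) (a ∸ i) (b ∸ suc j) ⟩
      rk i j + (a ∸ i) + suc (b ∸ suc j)                ≡⟨ cong (λ t → rk i j + (a ∸ i) + t) (sym (∸-suc b j j<b)) ⟩
      potential i j                                    ∎
      where open ≡-Reasoning

    diagram-northwest : ∀ i j → i ≤ a → j ≤ b → potential i j ≤ rk a b →
      Σ ℕ λ i′ → Σ ℕ λ j′ → InDiagram i′ j′ × (potential i′ j′ ≤ rk a b)
    diagram-northwest zero j _ _ small = ⊥-elim (ℕP.<-irrefl refl (ℕP.<-≤-trans deficient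
      (ℕP.≤-trans (ℕP.m⊓n≤m a b) (ℕP.≤-trans (ℕP.m≤m+n a (b ∸ j)) small))))
    diagram-northwest (suc i) zero _ _ small = ⊥-elim (ℕP.<-irrefl refl (ℕP.<-≤-trans deficient
      (ℕP.≤-trans (ℕP.m⊓n≤n a b) (ℕP.≤-trans (ℕP.m≤n+m b _)
        (subst (λ t → t + (a ∸ suc i) + b ≤ rk a b) (rk-col-zero (suc i)) small)))))
    diagram-northwest (suc i) (suc j) i<a j<b small
      with rowBit (suc i) (suc j) ℕ.≟ 0 | colBit (suc i) (suc j) ℕ.≟ 0
    ... | yes row0 | yes col0 =
      suc i , suc j , (s≤s z≤n , ℕP.≤-trans i<a a≤n , s≤s z≤n , ℕP.≤-trans j<b b≤n , row0 , col0) , small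
    ... | no row≢0 | _ =
      diagram-northwest i (suc j) (ℕP.<⇒≤ i<a) j<b
        (subst (_≤ rk a b) (potential-up i (suc j) i<a (bit-one _ (rowBit≤1 (suc i) (suc j)) row≢0)) small)
    ... | yes _ | no col≢0 =
      diagram-northwest (suc i) j i<a (ℕP.<⇒≤ j<b)
        (subst (_≤ rk a b) (potential-left (suc i) j j<b (bit-one _ (colBit≤1 (suc i) (suc j)) col≢0)) small)

    essential-witness : Σ ℕ λ i → Σ ℕ λ j → Ess A i j × (potential i j ≤ rk a b)
    essential-witness with diagram-northwest a b ℕP.≤-refl ℕP.≤-refl (ℕP.≤-reflexive start)
      where
      start : potential a b ≡ rk a b
      start = trans (cong₂ (λ u v → rk a b + u + v) (ℕP.n∸n≡0 a) (ℕP.n∸n≡0 b))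
                    (trans (ℕP.+-identityʳ _) (ℕP.+-identityʳ _))
    ... | i , j , d@(_ , i≤n , _ , j≤n , _) , small
      with essential-southeast (n ∸ i) (n ∸ j) i j (ℕP.m∸n+n≡m i≤n) (ℕP.m∸n+n≡m j≤n) d
    ... | i′ , j′ , ess , i≤i′ , j≤j′ , same =
      i′ , j′ , ess , ℕP.≤-trans (ℕP.+-mono-≤ (ℕP.+-mono-≤ (ℕP.≤-reflexive same) (ℕP.∸-monoʳ-≤ a i≤i′))
                                               (ℕP.∸-monoʳ-≤ b j≤j′)) small

inRange : ℕ → ℕ → ℕ
inRange b zero    = 0
inRange b (suc x) with x <? b
... | yes _ = 1
... | no  _ = 0

count : ℕ → List ℕ → ℕ
count b []       = 0
count b (x ∷ xs) = inRange b x + count b xs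

countFirst : ℕ → ℕ → List ℕ → ℕ
countFirst zero    b xs       = 0
countFirst (suc a) b []       = 0
countFirst (suc a) b (x ∷ xs) = inRange b x + countFirst a b xs

inRange-zero : ∀ x → inRange 0 x ≡ 0
inRange-zero zero    = refl
inRange-zero (suc x) with x <? 0
... | no _ = refl

inRange-out : ∀ b x → b ≤ x → inRange b (suc x) ≡ 0
inRange-out b x b≤x with x <? b
... | yes x<b = ⊥-elim (ℕP.<-irrefl refl (ℕP.<-≤-trans x<b b≤x))
... | no _    = refl

inRange-in : ∀ b x → x < b → inRange b (suc x) ≡ 1
inRange-in b x x<b with x <? b
... | yes _   = refl
... | no x≮b = ⊥-elim (x≮b x<b)

inRange≤1 : ∀ b x → inRange b x ≤ 1
inRange≤1 b zero    = z≤n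
inRange≤1 b (suc x) with x <? b
... | yes _ = s≤s z≤n
... | no _  = z≤n

inRange-step : ∀ b c → c ≢ suc b → inRange (suc b) c ≡ inRange b c
inRange-step b zero    _ = refl
inRange-step b (suc x) c≢ with x <? b | x <? suc b
... | yes _   | yes _    = refl
... | no _    | no _     = refl
... | yes x<b | no x≮sb = ⊥-elim (x≮sb (ℕP.m≤n⇒m≤1+n x<b))
... | no x≮b  | yes x<sb with ℕP.m≤n⇒m<n∨m≡n (ℕ.s≤s⁻¹ x<sb)
...   | inj₁ x<b  = ⊥-elim (x≮b x<b)
...   | inj₂ refl = ⊥-elim (c≢ refl)

count-++ : ∀ b xs ys → count b (xs ++ ys) ≡ count b xs + count b ys
count-++ b []       ys = refl
count-++ b (x ∷ xs) ys rewrite count-++ b xs ys = sym (ℕP.+-assoc (inRange b x) _ _)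

countFirst-++ : ∀ a b xs ys → countFirst a b (xs ++ ys) ≡ countFirst a b xs + countFirst (a ∸ length xs) b ys
countFirst-++ zero    b xs       ys rewrite ℕP.0∸n≡0 (length xs) = refl
countFirst-++ (suc a) b []       ys = refl
countFirst-++ (suc a) b (x ∷ xs) ys rewrite countFirst-++ a b xs ys = sym (ℕP.+-assoc (inRange b x) _ _)

count≤length : ∀ b xs → count b xs ≤ length xs
count≤length b []       = z≤n
count≤length b (x ∷ xs) = ℕP.+-mono-≤ (inRange≤1 b x) (count≤length b xs)

count-split : ∀ {P : ℕ → Set} (P? : Decidable P) b xs →
              count b (filter (λ c → ¬? (P? c)) xs) + count b (filter P? xs) ≡ count b xs
count-split P? b [] = refl
count-split P? b (x ∷ xs) with P? x
... | yes _ rewrite sym (count-split P? b xs) = swap-front (count b (filter (λ c → ¬? (P? c)) xs)) (inRange b x) _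
  where
  swap-front : ∀ u h v → u + (h + v) ≡ h + (u + v)
  swap-front = ℕSolver.solve-∀
... | no _  rewrite sym (count-split P? b xs) = ℕP.+-assoc (inRange b x) _ _

Increasing : ℕ → List ℕ → Set
Increasing lo []       = ⊤
Increasing lo (x ∷ xs) = (lo < x) × Increasing x xs

increasing-weaken : ∀ {lo lo′} xs → lo ≤ lo′ → Increasing lo′ xs → Increasing lo xs
increasing-weaken []       _     _           = tt
increasing-weaken (x ∷ xs) lo≤lo′ (lo′<x , inc) = ℕP.<-≤-trans (s≤s lo≤lo′) lo′<x , inc

increasing-filter : ∀ {P : ℕ → Set} (P? : Decidable P) lo xs → Increasing lo xs → Increasing lo (filter P? xs)
increasing-filter P? lo []       _             = tt
increasing-filter P? lo (x ∷ xs) (lo<x , inc) with does (P? x)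
... | true  = lo<x , increasing-filter P? x xs inc
... | false = increasing-filter P? lo xs (increasing-weaken xs (ℕP.<⇒≤ lo<x) inc)

∈-increasing : ∀ {lo c} xs → Increasing lo xs → c ∈ xs → lo < c
∈-increasing (x ∷ xs) (lo<x , _)   (here refl) = lo<x
∈-increasing (x ∷ xs) (lo<x , inc) (there c∈) = ℕP.<-trans lo<x (∈-increasing xs inc c∈)

increasing-skip : ∀ {lo} xs → Increasing lo xs → ¬ (suc lo ∈ xs) → Increasing (suc lo) xs
increasing-skip []       _            _ = tt
increasing-skip (x ∷ xs) (lo<x , inc) lo+1∉ with ℕP.m≤n⇒m<n∨m≡n lo<x
... | inj₁ lo+1<x = lo+1<x , inc
... | inj₂ refl   = ⊥-elim (lo+1∉ (here refl))

count-above : ∀ b lo xs → Increasing lo xs → b ≤ lo → count b xs ≡ 0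
count-above b lo []            _           _    = refl
count-above b lo (suc x ∷ xs) (lo<x , inc) b≤lo
  rewrite inRange-out b x (ℕP.≤-trans b≤lo (ℕ.s≤s⁻¹ lo<x)) =
  count-above b (suc x) xs inc (ℕP.≤-trans b≤lo (ℕP.<⇒≤ lo<x))

countFirst-above : ∀ a b lo xs → Increasing lo xs → b ≤ lo → countFirst a b xs ≡ 0
countFirst-above zero    b lo xs            _           _    = refl
countFirst-above (suc a) b lo []            _           _    = refl
countFirst-above (suc a) b lo (suc x ∷ xs) (lo<x , inc) b≤lo
  rewrite inRange-out b x (ℕP.≤-trans b≤lo (ℕ.s≤s⁻¹ lo<x)) =
  countFirst-above a b (suc x) xs inc (ℕP.≤-trans b≤lo (ℕP.<⇒≤ lo<x))

-- in an increasing list the entries in 1..b form an initial segment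
countFirst-increasing : ∀ a b lo xs → Increasing lo xs → countFirst a b xs ≡ a ⊓ count b xs
countFirst-increasing zero    b lo xs            _ = refl
countFirst-increasing (suc a) b lo []            _ = refl
countFirst-increasing (suc a) b lo (suc x ∷ xs) (_ , inc) with x <? b
... | yes _  = cong suc (countFirst-increasing a b (suc x) xs inc)
... | no x≮b rewrite countFirst-above a b (suc x) xs inc (ℕP.≤-trans (ℕP.≮⇒≥ x≮b) (ℕP.n≤1+n x))
                   | count-above b (suc x) xs inc (ℕP.≤-trans (ℕP.≮⇒≥ x≮b) (ℕP.n≤1+n x)) = refl

count-all : ∀ b lo xs → Increasing lo xs → All (_≤ b) xs → count b xs ≡ length xs
count-all b lo []            _         _           = refl
count-all b lo (suc x ∷ xs) (_ , inc) (x<b ∷ bnd) rewrite inRange-in b x x<b = cong suc (count-all b (suc x) xs inc bnd)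

range : ℕ → ℕ → List ℕ
range s zero    = []
range s (suc k) = s ∷ range (suc s) k

upTo≡range : ∀ n → map suc (upTo n) ≡ range 1 n
upTo≡range n = shifted n (λ i → i) 0 (λ i → refl)
  where
  shifted : ∀ k (f : ℕ → ℕ) s → (∀ i → f i ≡ s + i) → map suc (applyUpTo f k) ≡ range (suc s) k
  shifted zero    f s e = refl
  shifted (suc k) f s e = cong₂ _∷_ (cong suc (trans (e 0) (ℕP.+-identityʳ s)))
                                    (shifted k (λ i → f (suc i)) (suc s) (λ i → trans (e (suc i)) (ℕP.+-suc s i)))

range-length : ∀ s k → length (range s k) ≡ k
range-length s zero    = refl
range-length s (suc k) = cong suc (range-length (suc s) k)

range-increasing : ∀ s k → Increasing s (range (suc s) k)
range-increasing s zero    = tt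
range-increasing s (suc k) = ℕP.≤-refl , range-increasing (suc s) k

range-++-increasing : ∀ s k ys → Increasing (s + k) ys → Increasing s (range (suc s) k ++ ys)
range-++-increasing s zero    ys inc = subst (λ t → Increasing t ys) (ℕP.+-identityʳ s) inc
range-++-increasing s (suc k) ys inc =
  ℕP.≤-refl , range-++-increasing (suc s) k ys (subst (λ t → Increasing t ys) (ℕP.+-suc s k) inc)

range-bounded : ∀ n s k → s + k ≤ n → All (_≤ n) (range (suc s) k)
range-bounded n s zero    _ = []
range-bounded n s (suc k) le =
  ℕP.≤-trans (s≤s (ℕP.m≤m+n s k)) (ℕP.≤-trans (ℕP.≤-reflexive (sym (ℕP.+-suc s k))) le) ∷
  range-bounded n (suc s) k (ℕP.≤-trans (ℕP.≤-reflexive (sym (ℕP.+-suc s k))) le)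

count-range : ∀ b s k → count b (range (suc s) k) ≡ (b ∸ s) ⊓ k
count-range b s zero    = sym (ℕP.⊓-zeroʳ (b ∸ s))
count-range b s (suc k) with s <? b
... | yes s<b rewrite count-range b (suc s) k | ℕP.+-∸-assoc 1 s<b = refl
... | no s≮b  rewrite count-range b (suc s) k | ℕP.m≤n⇒m∸n≡0 (ℕP.≮⇒≥ s≮b)
                    | ℕP.m≤n⇒m∸n≡0 (ℕP.≤-trans (ℕP.≮⇒≥ s≮b) (ℕP.n≤1+n s)) = refl

filter-range-members : ∀ k s F Fb → Increasing s F → All (_≤ s + k) F →
  (∀ c → s < c → (c ∈ Fb → c ∈ F) × (c ∈ F → c ∈ Fb)) →
  filter (_∈? Fb) (range (suc s) k) ≡ F
filter-range-members zero s [] Fb _ _ _ = refl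
filter-range-members zero s (x ∷ F) Fb (s<x , _) (x≤s ∷ _) _ =
  ⊥-elim (ℕP.<-irrefl refl (ℕP.<-≤-trans s<x (subst (x ≤_) (ℕP.+-identityʳ s) x≤s)))
filter-range-members (suc k) s F Fb inc bnd agree with suc s ∈? Fb
filter-range-members (suc k) s F Fb inc bnd agree | yes s+1∈Fb
  with proj₁ (agree (suc s) ℕP.≤-refl) s+1∈Fb
filter-range-members (suc k) s (x ∷ F) Fb (_ , inc) (_ ∷ bnd) agree | yes _ | here refl =
  cong (suc s ∷_) (filter-range-members k (suc s) F Fb inc (subst (λ t → All (_≤ t) F) (ℕP.+-suc s k) bnd)
    (λ c s+1<c → (λ c∈Fb → drop-head c s+1<c (proj₁ (agree c (ℕP.<-trans ℕP.≤-refl s+1<c)) c∈Fb)) ,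
                  λ c∈F → proj₂ (agree c (ℕP.<-trans ℕP.≤-refl s+1<c)) (there c∈F)))
  where
  drop-head : ∀ c → suc s < c → c ∈ (suc s ∷ F) → c ∈ F
  drop-head c s+1<c (here refl) = ⊥-elim (ℕP.<-irrefl refl s+1<c)
  drop-head c s+1<c (there c∈F) = c∈F
filter-range-members (suc k) s (x ∷ F) Fb (s<x , inc) _ agree | yes _ | there s+1∈F =
  ⊥-elim (ℕP.<-irrefl refl (ℕP.<-≤-trans (∈-increasing F inc s+1∈F) s<x))
filter-range-members (suc k) s F Fb inc bnd agree | no s+1∉Fb =
  filter-range-members k (suc s) F Fb (increasing-skip F inc (λ s+1∈F → s+1∉Fb (proj₂ (agree (suc s) ℕP.≤-refl) s+1∈F)))
    (subst (λ t → All (_≤ t) F) (ℕP.+-suc s k) bnd) (λ c s+1<c → agree c (ℕP.<-trans ℕP.≤-refl s+1<c))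

module CountFiltered {Q : ℕ → Set} (Q? : Decidable Q) where

  indicator : ℕ → ℕ
  indicator x with Q? x
  ... | yes _ = 1
  ... | no _  = 0

  indicator-yes : ∀ x → Q x → indicator x ≡ 1
  indicator-yes x q with Q? x
  ... | yes _ = refl
  ... | no ¬q = ⊥-elim (¬q q)

  indicator-no : ∀ x → ¬ Q x → indicator x ≡ 0
  indicator-no x ¬q with Q? x
  ... | yes q = ⊥-elim (¬q q)
  ... | no _  = refl

  private
    raise-yes : ∀ b s → indicator (suc s) ≡ 1 →
                inRange b (suc s) + sumℕ (s ⊓ b) indicator ≡ sumℕ (suc s ⊓ b) indicator
    raise-yes b s one with s <? b
    ... | yes s<b rewrite ℕP.m≤n⇒m⊓n≡m (ℕP.<⇒≤ s<b) | ℕP.m≤n⇒m⊓n≡m s<b | one = ℕP.+-comm 1 _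
    ... | no s≮b  rewrite ℕP.m≥n⇒m⊓n≡n (ℕP.≮⇒≥ s≮b)
                        | ℕP.m≥n⇒m⊓n≡n (ℕP.≤-trans (ℕP.≮⇒≥ s≮b) (ℕP.n≤1+n s)) = refl

    raise-no : ∀ b s → indicator (suc s) ≡ 0 → sumℕ (s ⊓ b) indicator ≡ sumℕ (suc s ⊓ b) indicator
    raise-no b s zero′ with s <? b
    ... | yes s<b rewrite ℕP.m≤n⇒m⊓n≡m (ℕP.<⇒≤ s<b) | ℕP.m≤n⇒m⊓n≡m s<b | zero′ = sym (ℕP.+-identityʳ _)
    ... | no s≮b  rewrite ℕP.m≥n⇒m⊓n≡n (ℕP.≮⇒≥ s≮b)
                        | ℕP.m≥n⇒m⊓n≡n (ℕP.≤-trans (ℕP.≮⇒≥ s≮b) (ℕP.n≤1+n s)) = refl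

    rotate : ∀ h c x y → h + x ≡ y → (h + c) + x ≡ c + y
    rotate h c x y refl = rearrange h c x
      where
      rearrange : ∀ h c x → (h + c) + x ≡ c + (h + x)
      rearrange = ℕSolver.solve-∀

    count-filter : ∀ b s k → count b (filter Q? (range (suc s) k)) + sumℕ (s ⊓ b) indicator
                             ≡ sumℕ (b ⊓ (s + k)) indicator
    count-filter b s zero rewrite ℕP.+-identityʳ s = cong (λ t → sumℕ t indicator) (ℕP.⊓-comm s b)
    count-filter b s (suc k) with Q? (suc s)
    ... | yes q = trans (rotate (inRange b (suc s)) (count b (filter Q? (range (suc (suc s)) k))) _ _
                                (raise-yes b s (indicator-yes (suc s) q)))
                        (trans (count-filter b (suc s) k) (cong (λ t → sumℕ (b ⊓ t) indicator) (sym (ℕP.+-suc s k))))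
    ... | no ¬q = trans (cong (λ t → count b (filter Q? (range (suc (suc s)) k)) + t) (raise-no b s (indicator-no (suc s) ¬q)))
                        (trans (count-filter b (suc s) k) (cong (λ t → sumℕ (b ⊓ t) indicator) (sym (ℕP.+-suc s k))))

  count-filter-range : ∀ b k → b ≤ k → count b (filter Q? (range 1 k)) ≡ sumℕ b indicator
  count-filter-range b k b≤k = begin
    count b (filter Q? (range 1 k))      ≡⟨ sym (ℕP.+-identityʳ _) ⟩
    count b (filter Q? (range 1 k)) + 0  ≡⟨ count-filter b 0 k ⟩
    sumℕ (b ⊓ k) indicator               ≡⟨ cong (λ t → sumℕ t indicator) (ℕP.m≤n⇒m⊓n≡m b≤k) ⟩
    sumℕ b indicator                     ∎
    where open ≡-Reasoning

module WordMatrix {n : ℕ} (w : List ℕ) where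
  open Access (permMat {n} w)

  private
    B : Mat n
    B = permMat w

    entry-one : ∀ (i j : Fin n) → part w (suc (toℕ i)) ≡ suc (toℕ j) → B i j ≡ + 1
    entry-one i j e with part w (suc (toℕ i)) ℕ.≟ suc (toℕ j)
    ... | yes _ = refl
    ... | no ne = ⊥-elim (ne e)

    entry-zero : ∀ (i j : Fin n) → part w (suc (toℕ i)) ≢ suc (toℕ j) → B i j ≡ + 0
    entry-zero i j ne with part w (suc (toℕ i)) ℕ.≟ suc (toℕ j)
    ... | yes e = ⊥-elim (ne e)
    ... | no _  = refl

    at-one : ∀ k l (k<n : k < n) (l<n : l < n) → part w (suc k) ≡ suc l → at B (suc k) (suc l) ≡ + 1
    at-one k l k<n l<n e =
      trans (at-inside k l k<n l<n)
            (entry-one _ _ (trans (cong (λ t → part w (suc t)) (FinP.toℕ-fromℕ< k<n))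
                                  (trans e (cong suc (sym (FinP.toℕ-fromℕ< l<n))))))

    at-zero : ∀ k l (k<n : k < n) (l<n : l < n) → part w (suc k) ≢ suc l → at B (suc k) (suc l) ≡ + 0
    at-zero k l k<n l<n ne =
      trans (at-inside k l k<n l<n)
            (entry-zero _ _ (λ e → ne (trans (cong (λ t → part w (suc t)) (sym (FinP.toℕ-fromℕ< k<n)))
                                             (trans e (cong suc (FinP.toℕ-fromℕ< l<n))))))

    row-prefix : ∀ k (k<n : k < n) b → b ≤ n → sumR b (at B (suc k)) ≡ + inRange b (part w (suc k))
    row-prefix k k<n zero    _   = cong +_ (sym (inRange-zero (part w (suc k))))
    row-prefix k k<n (suc b) b<n rewrite row-prefix k k<n b (ℕP.<⇒≤ b<n)
      with part w (suc k) ℕ.≟ suc b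
    ... | yes e rewrite at-one k b k<n b<n e | e | inRange-out b b ℕP.≤-refl
                      | inRange-in (suc b) b ℕP.≤-refl = refl
    ... | no ne rewrite at-zero k b k<n b<n ne | inRange-step b (part w (suc k)) ne = ℤP.+-identityʳ _

    rows-count : ∀ a b (v : List ℕ) → sumℕ a (λ k → inRange b (part v k)) ≡ countFirst a b v
    rows-count zero    b v       = refl
    rows-count (suc a) b []      = sumℕ-zero (suc a) (λ k → refl)
    rows-count (suc a) b (x ∷ v) =
      trans (sumℕ-head a _) (cong (λ t → inRange b x + t) (trans (sumℕ-cong a (λ k → refl)) (rows-count a b v)))

  rank-word : ∀ a b → a ≤ n → b ≤ n → r B a b ≡ + countFirst a b w
  rank-word a b a≤n b≤n =
    trans (sumR-cong< a (λ k k<a → row-prefix k (ℕP.<-≤-trans k<a a≤n) b b≤n))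
          (trans (sumR-ℕ a _) (cong +_ (rows-count a b w)))

complement : ℕ → List ℕ → List ℕ
complement n F = filter (λ c → ¬? (c ∈? F)) (map suc (upTo n))

complement-increasing : ∀ n F → Increasing 0 (complement n F)
complement-increasing n F =
  increasing-filter (λ c → ¬? (c ∈? F)) 0 (map suc (upTo n)) (subst (Increasing 0) (sym (upTo≡range n)) (range-increasing 0 n))

count-complement : ∀ n F → Increasing 0 F → All (_≤ n) F → ∀ b → b ≤ n →
                   count b (complement n F) ≡ b ∸ count b F
count-complement n F inc bnd b b≤n = begin
  count b (complement n F)                                      ≡⟨ sym (ℕP.m+n∸n≡m _ (count b F)) ⟩
  count b (complement n F) + count b F ∸ count b F              ≡⟨ cong (λ t → count b (complement n F) + count b t ∸ count b F) (sym members) ⟩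
  count b (complement n F) + count b (filter (_∈? F) U) ∸ count b F ≡⟨ cong (_∸ count b F) (count-split (_∈? F) b U) ⟩
  count b U ∸ count b F                                         ≡⟨ cong (λ t → count b t ∸ count b F) (upTo≡range n) ⟩
  count b (range 1 n) ∸ count b F                               ≡⟨ cong (_∸ count b F) (trans (count-range b 0 n) (ℕP.m≤n⇒m⊓n≡m b≤n)) ⟩
  b ∸ count b F                                                 ∎
  where
  open ≡-Reasoning
  U = map suc (upTo n)
  members : filter (_∈? F) U ≡ F
  members = trans (cong (filter (_∈? F)) (upTo≡range n))
                  (filter-range-members n 0 F F inc bnd (λ c _ → (λ c∈ → c∈) , (λ c∈ → c∈)))

grassmannian-rank : ∀ n F → Increasing 0 F → All (_≤ n) F → ∀ a b → a ≤ n → b ≤ n →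
  r (permMat {n} (F ++ complement n F)) a b ≡ + ((a ⊓ count b F) + ((a ∸ length F) ⊓ (b ∸ count b F)))
grassmannian-rank n F inc bnd a b a≤n b≤n = trans (WordMatrix.rank-word (F ++ complement n F) a b a≤n b≤n) (cong +_ (begin
  countFirst a b (F ++ complement n F)
    ≡⟨ countFirst-++ a b F (complement n F) ⟩
  countFirst a b F + countFirst (a ∸ length F) b (complement n F)
    ≡⟨ cong₂ _+_ (countFirst-increasing a b 0 F inc)
                 (countFirst-increasing (a ∸ length F) b 0 (complement n F) (complement-increasing n F)) ⟩
  (a ⊓ count b F) + ((a ∸ length F) ⊓ count b (complement n F))
    ≡⟨ cong (λ t → (a ⊓ count b F) + ((a ∸ length F) ⊓ t)) (count-complement n F inc bnd b b≤n) ⟩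
  (a ⊓ count b F) + ((a ∸ length F) ⊓ (b ∸ count b F)) ∎))
  where open ≡-Reasoning

grassmannian-lower : ∀ x a b c d → c ≤ d → x ≤ a → x ≤ b → x ≤ c + (a ∸ d) →
                     x ≤ (a ⊓ c) + ((a ∸ d) ⊓ (b ∸ c))
grassmannian-lower x a b c d c≤d x≤a x≤b x≤ with ℕP.≤-total a d
... | inj₁ a≤d rewrite ℕP.m≤n⇒m∸n≡0 a≤d | ℕP.+-identityʳ (a ⊓ c) =
  ℕP.⊓-glb x≤a (subst (x ≤_) (ℕP.+-identityʳ c) x≤)
... | inj₂ d≤a rewrite ℕP.m≥n⇒m⊓n≡n (ℕP.≤-trans c≤d d≤a) | ℕP.+-distribˡ-⊓ c (a ∸ d) (b ∸ c) =
  ℕP.⊓-glb x≤ (ℕP.≤-trans x≤b (ℕP.m≤n+m∸n b c))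

grassmannian-upper : ∀ a c d e → (a ⊓ c) + ((a ∸ d) ⊓ e) ≤ c + (a ∸ d)
grassmannian-upper a c d e = ℕP.+-mono-≤ (ℕP.m⊓n≤n a c) (ℕP.m⊓n≤m (a ∸ d) e)

part-ext : ∀ (xs ys : List ℕ) → length xs ≡ length ys →
           (∀ t → t < length xs → part xs (suc t) ≡ part ys (suc t)) → xs ≡ ys
part-ext []       []       _   _ = refl
part-ext (x ∷ xs) (y ∷ ys) len e =
  cong₂ _∷_ (e 0 (s≤s z≤n)) (part-ext xs ys (ℕP.suc-injective len) (λ t t< → e (suc t) (s≤s t<)))

part-map : ∀ (f : ℕ → ℕ) xs t → t < length xs → part (map f xs) (suc t) ≡ f (part xs (suc t))
part-map f (x ∷ xs) zero    _        = refl
part-map f (x ∷ xs) (suc t) (s≤s t<) = part-map f xs t t<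

part-upTo : ∀ d t → t < d → part (upTo d) (suc t) ≡ t
part-upTo d t t<d = shifted (λ i → i) d t t<d
  where
  shifted : ∀ (f : ℕ → ℕ) d t → t < d → part (applyUpTo f d) (suc t) ≡ f t
  shifted f (suc d) zero    _        = refl
  shifted f (suc d) (suc t) (s≤s t<) = shifted (λ i → f (suc i)) d t t<

part-zipWith : ∀ (f : ℕ → ℕ → ℕ) xs ys t → t < length xs → t < length ys →
               part (zipWith f xs ys) (suc t) ≡ f (part xs (suc t)) (part ys (suc t))
part-zipWith f (x ∷ xs) (y ∷ ys) zero    _         _         = refl
part-zipWith f (x ∷ xs) (y ∷ ys) (suc t) (s≤s t<x) (s≤s t<y) = part-zipWith f xs ys t t<x t<y

part-++ˡ : ∀ (xs ys : List ℕ) t → t < length xs → part (xs ++ ys) (suc t) ≡ part xs (suc t)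
part-++ˡ (x ∷ xs) ys zero    _        = refl
part-++ˡ (x ∷ xs) ys (suc t) (s≤s t<) = part-++ˡ xs ys t t<

part-++ʳ : ∀ (xs ys : List ℕ) u → part (xs ++ ys) (suc (length xs + u)) ≡ part ys (suc u)
part-++ʳ []       ys u = refl
part-++ʳ (x ∷ xs) ys u = part-++ʳ xs ys u

part-reverse : ∀ (xs : List ℕ) t → t < length xs → part (reverse xs) (suc t) ≡ part xs (length xs ∸ t)
part-reverse (x ∷ xs) t t< rewrite ListP.unfold-reverse x xs with ℕP.m≤n⇒m<n∨m≡n (ℕ.s≤s⁻¹ t<)
... | inj₁ t<xs =
  trans (part-++ˡ (reverse xs) (x ∷ []) t (subst (t <_) (sym (ListP.length-reverse xs)) t<xs))
        (trans (part-reverse xs t t<xs)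
               (sym (in-tail (length xs ∸ t) (ℕP.+-∸-assoc 1 (ℕP.<⇒≤ t<xs)) (ℕP.m<n⇒0<n∸m t<xs))))
  where
  in-tail : ∀ k → suc (length xs) ∸ t ≡ suc k → 0 < k → part (x ∷ xs) (suc (length xs) ∸ t) ≡ part xs k
  in-tail (suc k) e _ rewrite e = refl
... | inj₂ refl =
  trans (cong (λ u → part (reverse xs ++ x ∷ []) (suc u))
              (trans (sym (ListP.length-reverse xs)) (sym (ℕP.+-identityʳ _))))
        (trans (part-++ʳ (reverse xs) (x ∷ []) 0) (sym (cong (part (x ∷ xs)) (ℕP.m+n∸n≡m 1 (length xs)))))

part-range : ∀ s k t → t < k → part (range s k) (suc t) ≡ s + t
part-range s (suc k) zero    _        = sym (ℕP.+-identityʳ s)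
part-range s (suc k) (suc t) (s≤s t<) = trans (part-range (suc s) k t t<) (sym (ℕP.+-suc s t))

part-replicate : ∀ m v k → k < m → part (replicate m v) (suc k) ≡ v
part-replicate (suc m) v zero    _        = refl
part-replicate (suc m) v (suc k) (s≤s k<) = part-replicate m v k k<

part-replicate-beyond : ∀ m v k → m ≤ k → part (replicate m v) (suc k) ≡ 0
part-replicate-beyond zero    v k       _         = refl
part-replicate-beyond (suc m) v (suc k) (s≤s m≤k) = part-replicate-beyond m v k m≤k

part-increasing : ∀ lo xs t → Increasing lo xs → t < length xs → lo + suc t ≤ part xs (suc t)
part-increasing lo (x ∷ xs) zero    (lo<x , _)   _ = subst (_≤ x) (sym (ℕP.+-comm lo 1)) lo<x
part-increasing lo (x ∷ xs) (suc t) (lo<x , inc) (s≤s t<) =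
  ℕP.≤-trans (ℕP.≤-reflexive (ℕP.+-suc lo (suc t)))
             (ℕP.≤-trans (ℕP.+-monoˡ-≤ (suc t) lo<x) (part-increasing x xs t inc t<))

-- The first d letters of [λ,d]_g:  λ_{d-t} + t + 1  for t = 0, ..., d-1.
-- By definition  gword n lam d  is  leading lam d ++ complement n (leading lam d).
leading : List ℕ → ℕ → List ℕ
leading lam d = map (λ t → part lam (d ∸ suc t + 1) + suc t) (upTo d)

leading-length : ∀ lam d → length (leading lam d) ≡ d
leading-length lam d = trans (ListP.length-map _ (upTo d)) (ListP.length-applyUpTo (λ i → i) d)

part-leading : ∀ lam d t → t < d → part (leading lam d) (suc t) ≡ part lam (suc (d ∸ suc t)) + suc t
part-leading lam d t t<d =
  trans (part-map _ (upTo d) t (subst (t <_) (sym (ListP.length-applyUpTo (λ i → i) d)) t<d))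
        (trans (cong (λ u → part lam (d ∸ suc u + 1) + suc u) (part-upTo d t t<d))
               (cong (λ k → part lam k + suc t) (ℕP.+-comm (d ∸ suc t) 1)))

triangleShape : List ℕ → List ℕ
triangleShape M = reverse (zipWith _∸_ M (map suc (upTo (length M))))

leading-triangleShape : ∀ M → Increasing 0 M → leading (triangleShape M) (length M) ≡ M
leading-triangleShape M inc = part-ext _ M (leading-length (triangleShape M) p) entry
  where
  p = length M
  U = map suc (upTo p)
  U-length : length U ≡ p
  U-length = trans (ListP.length-map suc (upTo p)) (ListP.length-applyUpTo (λ i → i) p)
  Z = zipWith _∸_ M U
  Z-length : length Z ≡ p
  Z-length = trans (ListP.length-zipWith _∸_ M U) (trans (cong (p ⊓_) U-length) (ℕP.⊓-idem p))
  entry : ∀ t → t < length (leading (triangleShape M) p) → part (leading (triangleShape M) p) (suc t) ≡ part M (suc t)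
  entry t t<′ = begin
    part (leading (triangleShape M) p) (suc t)       ≡⟨ part-leading (triangleShape M) p t t<p ⟩
    part (reverse Z) (suc k) + suc t                 ≡⟨ cong (_+ suc t) (part-reverse Z k (subst (k <_) (sym Z-length) k<p)) ⟩
    part Z (length Z ∸ k) + suc t                    ≡⟨ cong (λ q → part Z (q ∸ k) + suc t) Z-length ⟩
    part Z (p ∸ k) + suc t                           ≡⟨ cong (λ q → part Z q + suc t) (ℕP.m∸[m∸n]≡n t<p) ⟩
    part Z (suc t) + suc t                           ≡⟨ cong (_+ suc t) (part-zipWith _∸_ M U t t<p (subst (t <_) (sym U-length) t<p)) ⟩
    (part M (suc t) ∸ part U (suc t)) + suc t        ≡⟨ cong (λ q → (part M (suc t) ∸ q) + suc t) U-entry ⟩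
    (part M (suc t) ∸ suc t) + suc t                 ≡⟨ ℕP.m∸n+n≡m (part-increasing 0 M t inc t<p) ⟩
    part M (suc t)                                   ∎
    where
    open ≡-Reasoning
    t<p : t < p
    t<p = subst (t <_) (leading-length (triangleShape M) p) t<′
    k = p ∸ suc t
    k<p : k < p
    k<p = ℕP.∸-monoʳ-< (s≤s z≤n) t<p
    U-entry : part U (suc t) ≡ suc t
    U-entry = trans (part-map suc (upTo p) t (subst (t <_) (sym (ListP.length-applyUpTo (λ i → i) p)) t<p))
                    (cong suc (part-upTo p t t<p))

-- The Grassmannian permutation of the rectangle with i - ρ rows of length
-- j - ρ (ρ ≤ i, j) starts with 1, ..., ρ followed by j+1, ..., j+i-ρ:  its
-- t-th letter is t+1 while λ_{i-t} = 0 (t < ρ), and j - ρ + t + 1 afterwards.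
module RectangleLeading (i j ρ : ℕ) (ρ≤i : ρ ≤ i) (ρ≤j : ρ ≤ j) where
  private
    m = i ∸ ρ
    lam = rect m (j ∸ ρ)

  rectRange : List ℕ
  rectRange = range 1 ρ ++ range (suc j) m

  rectRange-length : length rectRange ≡ i
  rectRange-length = trans (ListP.length-++ (range 1 ρ))
                           (trans (cong₂ _+_ (range-length 1 ρ) (range-length (suc j) m)) (ℕP.m+[n∸m]≡n ρ≤i))

  private
    letter-low : ∀ t → t < i → t < ρ → part (leading lam i) (suc t) ≡ part rectRange (suc t)
    letter-low t t<i t<ρ = begin
      part (leading lam i) (suc t)       ≡⟨ part-leading lam i t t<i ⟩
      part lam (suc (i ∸ suc t)) + suc t ≡⟨ cong (_+ suc t) (part-replicate-beyond m _ (i ∸ suc t) (ℕP.∸-monoʳ-≤ i t<ρ)) ⟩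
      suc t                              ≡⟨ sym (part-range 1 ρ t t<ρ) ⟩
      part (range 1 ρ) (suc t)           ≡⟨ sym (part-++ˡ (range 1 ρ) _ t (subst (t <_) (sym (range-length 1 ρ)) t<ρ)) ⟩
      part rectRange (suc t)             ∎
      where open ≡-Reasoning

    shift : ∀ w u → (ρ + w ∸ ρ) + suc (ρ + u) ≡ suc (ρ + w) + u
    shift w u rewrite ℕP.m+n∸m≡n ρ w = rearrange w ρ u
      where
      rearrange : ∀ w ρ u → w + suc (ρ + u) ≡ suc (ρ + w) + u
      rearrange = ℕSolver.solve-∀

    letter-high : ∀ t → t < i → ρ ≤ t → part (leading lam i) (suc t) ≡ part rectRange (suc t)
    letter-high t t<i ρ≤t = begin
      part (leading lam i) (suc t)              ≡⟨ part-leading lam i t t<i ⟩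
      part lam (suc (i ∸ suc t)) + suc t        ≡⟨ cong (_+ suc t) (part-replicate m _ (i ∸ suc t) (ℕP.∸-monoʳ-< (s≤s ρ≤t) t<i)) ⟩
      (j ∸ ρ) + suc t                           ≡⟨ cong (λ q → (j ∸ ρ) + suc q) (sym ρ+u≡t) ⟩
      (j ∸ ρ) + suc (ρ + u)                     ≡⟨ subst (λ J → (J ∸ ρ) + suc (ρ + u) ≡ suc J + u) (ℕP.m+[n∸m]≡n ρ≤j) (shift (j ∸ ρ) u) ⟩
      suc j + u                                 ≡⟨ sym (part-range (suc j) m u (ℕP.∸-monoˡ-< t<i ρ≤t)) ⟩
      part (range (suc j) m) (suc u)            ≡⟨ sym (part-++ʳ (range 1 ρ) (range (suc j) m) u) ⟩
      part rectRange (suc (length (range 1 ρ) + u)) ≡⟨ cong (λ q → part rectRange (suc q)) (trans (cong (_+ u) (range-length 1 ρ)) ρ+u≡t) ⟩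
      part rectRange (suc t)                    ∎
      where
      open ≡-Reasoning
      u = t ∸ ρ
      ρ+u≡t : ρ + u ≡ t
      ρ+u≡t = ℕP.m+[n∸m]≡n ρ≤t

  leading-rect : leading (rect (i ∸ ρ) (j ∸ ρ)) i ≡ rectRange
  leading-rect = part-ext _ rectRange (trans (leading-length lam i) (sym rectRange-length)) letter
    where
    letter : ∀ t → t < length (leading lam i) → part (leading lam i) (suc t) ≡ part rectRange (suc t)
    letter t t<′ with t <? ρ
    ... | yes t<ρ = letter-low t t<i t<ρ
      where t<i = subst (t <_) (leading-length lam i) t<′
    ... | no t≮ρ  = letter-high t t<i (ℕP.≮⇒≥ t≮ρ)
      where t<i = subst (t <_) (leading-length lam i) t<′

joinR-greatest : ∀ {n} (L : List (Mat n)) a b x → x ℤ.≤ + (a ⊓ b) → (∀ B → B ∈ L → x ℤ.≤ r B a b) →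
                 x ℤ.≤ joinR L a b
joinR-greatest []      a b x x≤ _ = x≤
joinR-greatest (B ∷ L) a b x x≤ h = ℤP.⊓-glb (joinR-greatest L a b x x≤ (λ B′ B′∈ → h B′ (there B′∈))) (h B (here refl))

joinR≤min : ∀ {n} (L : List (Mat n)) a b → joinR L a b ℤ.≤ + (a ⊓ b)
joinR≤min []      a b = ℤP.≤-refl
joinR≤min (B ∷ L) a b = ℤP.≤-trans (ℤP.i⊓j≤i _ _) (joinR≤min L a b)

joinR≤member : ∀ {n} (L : List (Mat n)) a b B → B ∈ L → joinR L a b ℤ.≤ r B a b
joinR≤member (B ∷ L) a b .B (here refl) = ℤP.i⊓j≤j _ _
joinR≤member (B′ ∷ L) a b B (there B∈) = ℤP.≤-trans (ℤP.i⊓j≤i _ _) (joinR≤member L a b B B∈)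

fromR-recovers : ∀ {n} (A : Mat n) (R : ℕ → ℕ → ℤ) → (∀ a b → a ≤ n → b ≤ n → R a b ≡ r A a b) → A ≋ fromR R
fromR-recovers {n} A R agree k l = sym (begin
  fromR R k l
    ≡⟨ cong₂ ℤ._+_ (cong₂ _-_ (cong₂ _-_ (agree (suc k′) (suc l′) k<n l<n) (agree k′ (suc l′) (ℕP.<⇒≤ k<n) l<n))
                              (agree (suc k′) l′ k<n (ℕP.<⇒≤ l<n)))
                   (agree k′ l′ (ℕP.<⇒≤ k<n) (ℕP.<⇒≤ l<n)) ⟩
  ((r A (suc k′) (suc l′) - r A k′ (suc l′)) - r A (suc k′) l′) ℤ.+ r A k′ l′
    ≡⟨ second-difference (r A k′ (suc l′)) (sumR l′ (at A (suc k′))) (at A (suc k′) (suc l′)) (r A k′ l′) ⟩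
  at A (suc k′) (suc l′)
    ≡⟨ Access.at-fin A k l ⟩
  A k l ∎)
  where
  open ≡-Reasoning
  k′ = toℕ k
  l′ = toℕ l
  k<n = FinP.toℕ<n k
  l<n = FinP.toℕ<n l
  second-difference : ∀ X Y Z W → ((X ℤ.+ (Y ℤ.+ Z)) - X - (W ℤ.+ Y)) ℤ.+ W ≡ Z
  second-difference = ℤSolver.solve-∀

module JoinRecognition {n : ℕ} (A : Mat n) (asm : IsASM A) where
  open CornerSum A asm

  join-recognises : ∀ {X : Set} (xs : List X) (h : X → Mat n) →
    (∀ x → x ∈ xs → ∀ a b → a ≤ n → b ≤ n → r A a b ℤ.≤ r (h x) a b) →
    (∀ a b → a ≤ n → b ≤ n → rk a b < a ⊓ b → Σ X λ x → x ∈ xs × (r (h x) a b ℤ.≤ r A a b)) →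
    A ≋ join (map h xs)
  join-recognises xs h below attained = fromR-recovers A (joinR (map h xs)) same
    where
    same : ∀ a b → a ≤ n → b ≤ n → joinR (map h xs) a b ≡ r A a b
    same a b a≤n b≤n = ℤP.≤-antisym upper lower
      where
      rk≤min : rk a b ≤ a ⊓ b
      rk≤min = ℕP.⊓-glb (rk≤row a b) (rk≤col a b)

      lower : r A a b ℤ.≤ joinR (map h xs) a b
      lower = joinR-greatest (map h xs) a b (r A a b) (subst (ℤ._≤ + (a ⊓ b)) (sym (r≡rk a b)) (+≤+ rk≤min)) member
        where
        member : ∀ B → B ∈ map h xs → r A a b ℤ.≤ r B a b
        member B B∈ with ∈-map⁻ h B∈
        ... | x , x∈ , refl = below x x∈ a b a≤n b≤n

      upper : joinR (map h xs) a b ℤ.≤ r A a b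
      upper with ℕP.m≤n⇒m<n∨m≡n rk≤min
      ... | inj₂ rk≡min = subst (joinR (map h xs) a b ℤ.≤_) (trans (cong +_ (sym rk≡min)) (sym (r≡rk a b)))
                                (joinR≤min (map h xs) a b)
      ... | inj₁ rk<min with attained a b a≤n b≤n rk<min
      ...   | x , x∈ , small = ℤP.≤-trans (joinR≤member (map h xs) a b (h x) (∈-map⁺ h x∈)) small

∣m-n∣≡m∸n : ∀ x y → y ≤ x → ∣ + x - + y ∣ ≡ x ∸ y
∣m-n∣≡m∸n x y y≤x = cong ∣_∣ (trans (ℤP.m-n≡m⊖n x y) (ℤP.⊖-≥ y≤x))

-- Both consist of Grassmannian words
-- F ++ complement n F, one for each essential cell (i,j), with |F| = i and
--   r_A(i,b) ≤ #(F ∩ [1,b]) ≤ r_A(i,j) + (b - j)   for all b ≤ n.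
-- The first inequality places the permutation below A; the second makes its
-- corner sum at (a,b) at most the potential r_A(i,j) + (a - i) + (b - j),
-- which is ≤ r_A(a,b) for the essential cell supplied by essential-witness.
module Families {n : ℕ} (A : Mat n) (asm : IsASM A) where
  open CornerSum A asm
  open EssentialWitness A asm
  open JoinRecognition A asm

  record Fits (i j : ℕ) (F : List ℕ) : Set where
    field
      increasing  : Increasing 0 F
      bounded     : All (_≤ n) F
      length≡     : length F ≡ i
      count-lower : ∀ b → b ≤ n → rk i b ≤ count b F
      count-upper : ∀ b → b ≤ n → count b F ≤ rk i j + (b ∸ j)

  module _ {i j : ℕ} {F : List ℕ} (fits : Fits i j F) (a b : ℕ) (a≤n : a ≤ n) (b≤n : b ≤ n) where
    open Fits fits

    private
      rank : r (permMat {n} (F ++ complement n F)) a b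
             ≡ + ((a ⊓ count b F) + ((a ∸ i) ⊓ (b ∸ count b F)))
      rank = subst (λ d → r (permMat {n} (F ++ complement n F)) a b
                          ≡ + ((a ⊓ count b F) + ((a ∸ d) ⊓ (b ∸ count b F))))
                   length≡ (grassmannian-rank n F increasing bounded a b a≤n b≤n)

    fits-below : r A a b ℤ.≤ r (permMat {n} (F ++ complement n F)) a b
    fits-below = subst₂ ℤ._≤_ (sym (r≡rk a b)) (sym rank) (+≤+
      (grassmannian-lower (rk a b) a b (count b F) i
        (subst (count b F ≤_) length≡ (count≤length b F)) (rk≤row a b) (rk≤col a b)
        (ℕP.≤-trans (rk-row-Lipschitz a i b) (ℕP.+-monoˡ-≤ (a ∸ i) (count-lower b b≤n)))))

    fits-above : r (permMat {n} (F ++ complement n F)) a b ℤ.≤ + (rk i j + (a ∸ i) + (b ∸ j))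
    fits-above = subst (ℤ._≤ + (rk i j + (a ∸ i) + (b ∸ j))) (sym rank) (+≤+ (begin
      (a ⊓ count b F) + ((a ∸ i) ⊓ (b ∸ count b F)) ≤⟨ grassmannian-upper a (count b F) i (b ∸ count b F) ⟩
      count b F + (a ∸ i)                           ≤⟨ ℕP.+-monoˡ-≤ (a ∸ i) (count-upper b b≤n) ⟩
      rk i j + (b ∸ j) + (a ∸ i)                    ≡⟨ swap-last (rk i j) (b ∸ j) (a ∸ i) ⟩
      rk i j + (a ∸ i) + (b ∸ j)                    ∎))
      where
      open ℕP.≤-Reasoning
      swap-last : ∀ x y z → x + y + z ≡ x + z + y
      swap-last = ℕSolver.solve-∀

  essential-join : ∀ {X : Set} (xs : List X) (h : X → Mat n) →
    (∀ x → x ∈ xs → ∀ a b → a ≤ n → b ≤ n → r A a b ℤ.≤ r (h x) a b) →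
    (∀ i j → Ess A i j → Σ X λ x → x ∈ xs ×
       (∀ a b → a ≤ n → b ≤ n → r (h x) a b ℤ.≤ + (rk i j + (a ∸ i) + (b ∸ j)))) →
    A ≋ join (map h xs)
  essential-join xs h below covers = join-recognises xs h below attained
    where
    attained : ∀ a b → a ≤ n → b ≤ n → rk a b < a ⊓ b → Σ _ λ x → x ∈ xs × (r (h x) a b ℤ.≤ r A a b)
    attained a b a≤n b≤n deficient with essential-witness a b a≤n b≤n deficient
    ... | i , j , ess , small with covers i j ess
    ...   | x , x∈ , bounded =
      x , x∈ , ℤP.≤-trans (bounded a b a≤n b≤n) (subst (+ (rk i j + (a ∸ i) + (b ∸ j)) ℤ.≤_) (sym (r≡rk a b)) (+≤+ small))

  private
    rect-count-lower : ∀ y b i j ρ → y ≤ b → y ≤ i → y ≤ ρ + (b ∸ j) → ρ ≤ j → ρ ≤ i →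
                       y ≤ (b ⊓ ρ) + ((b ∸ j) ⊓ (i ∸ ρ))
    rect-count-lower y b i j ρ y≤b y≤i y≤ ρ≤j ρ≤i with ℕP.≤-total b j
    ... | inj₁ b≤j rewrite ℕP.m≤n⇒m∸n≡0 b≤j | ℕP.+-identityʳ (b ⊓ ρ) =
      ℕP.⊓-glb y≤b (subst (y ≤_) (ℕP.+-identityʳ ρ) y≤)
    ... | inj₂ j≤b rewrite ℕP.m≥n⇒m⊓n≡n (ℕP.≤-trans ρ≤j j≤b) | ℕP.+-distribˡ-⊓ ρ (b ∸ j) (i ∸ ρ)
                         | ℕP.m+[n∸m]≡n ρ≤i = ℕP.⊓-glb y≤ y≤i

  module Rectangle (i j : ℕ) (ess : Ess A i j) where
    private
      i≤n : i ≤ n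
      i≤n = proj₁ (proj₂ (proj₁ ess))
      j≤n : j ≤ n
      j≤n = proj₁ (proj₂ (proj₂ (proj₂ (proj₁ ess))))
      ρ = rk i j
      m = i ∸ ρ
      ρ≤i = rk≤row i j
      ρ≤j = rk≤col i j

    private
      module Leading = RectangleLeading i j ρ ρ≤i ρ≤j

    rectWord : List ℕ
    rectWord = Leading.rectRange

    rect-gword : gword n (rect ∣ + i - r A i j ∣ ∣ + j - r A i j ∣) i ≡ rectWord ++ complement n rectWord
    rect-gword rewrite r≡rk i j | ∣m-n∣≡m∸n i ρ ρ≤i | ∣m-n∣≡m∸n j ρ ρ≤j =
      cong (λ X → X ++ complement n X) Leading.leading-rect

    private
      j+m≤n : j + m ≤ n
      j+m≤n = ℕP.+-cancelʳ-≤ ρ (j + m) n (begin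
        j + m + ρ   ≡⟨ ℕP.+-assoc j m ρ ⟩
        j + (m + ρ) ≡⟨ cong (λ t → j + t) (ℕP.m∸n+n≡m ρ≤i) ⟩
        j + i       ≡⟨ ℕP.+-comm j i ⟩
        i + j       ≤⟨ rk-lower i j i≤n j≤n ⟩
        ρ + n       ≡⟨ ℕP.+-comm ρ n ⟩
        n + ρ       ∎)
        where open ℕP.≤-Reasoning

      count-rectWord : ∀ b → count b rectWord ≡ (b ⊓ ρ) + ((b ∸ j) ⊓ m)
      count-rectWord b = trans (count-++ b (range 1 ρ) (range (suc j) m))
                               (cong₂ _+_ (count-range b 0 ρ) (count-range b j m))

    rect-fits : Fits i j rectWord
    rect-fits = record
      { increasing  = range-++-increasing 0 ρ (range (suc j) m)
                        (increasing-weaken (range (suc j) m) ρ≤j (range-increasing j m))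
      ; bounded     = AllP.++⁺ (range-bounded n 0 ρ (ℕP.≤-trans ρ≤i i≤n)) (range-bounded n j m j+m≤n)
      ; length≡     = Leading.rectRange-length
      ; count-lower = λ b _ → subst (rk i b ≤_) (sym (count-rectWord b))
                                (rect-count-lower (rk i b) b i j ρ (rk≤col i b) (rk≤row i b)
                                                  (rk-col-Lipschitz i b j) ρ≤j ρ≤i)
      ; count-upper = λ b _ → subst (_≤ ρ + (b ∸ j)) (sym (count-rectWord b))
                                (ℕP.+-mono-≤ (ℕP.m⊓n≤n b ρ) (ℕP.m⊓n≤m (b ∸ j) m))
      }

  module TriangleRow (p : ℕ) (j : ℕ) (ess : Ess A p j) where
    private
      p≤n : p ≤ n
      p≤n = proj₁ (proj₂ (proj₁ ess))
      U = map suc (upTo n)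
      Q? = λ c → sumR p (λ k → at A k c) ℤ.≟ + 1
      open CountFiltered Q?

      M = mtRow A p

      M-increasing : Increasing 0 M
      M-increasing = increasing-filter Q? 0 U (subst (Increasing 0) (sym (upTo≡range n)) (range-increasing 0 n))

      M-bounded : All (_≤ n) M
      M-bounded = AllP.filter⁺ Q? (subst (All (_≤ n)) (sym (upTo≡range n)) (range-bounded n 0 n ℕP.≤-refl))

      indicator≡colBit : ∀ c → indicator c ≡ colBit p c
      indicator≡colBit c with colPrefix-bit p c
      ... | inj₁ zero′ = trans (indicator-no c (λ one → case (trans (sym zero′) one))) (sym (cong ∣_∣ zero′))
        where
        case : + 0 ≡ + 1 → ⊥
        case ()
      ... | inj₂ one = trans (indicator-yes c one) (sym (cong ∣_∣ one))

      rk≡colBits : ∀ b → rk p b ≡ sumℕ b (colBit p)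
      rk≡colBits zero    = rk-col-zero p
      rk≡colBits (suc b) = trans (rk-col-step p b) (cong (_+ colBit p (suc b)) (rk≡colBits b))

      count-M : ∀ b → b ≤ n → count b M ≡ rk p b
      count-M b b≤n = begin
        count b M                       ≡⟨ cong (λ L → count b (filter Q? L)) (upTo≡range n) ⟩
        count b (filter Q? (range 1 n)) ≡⟨ count-filter-range b n b≤n ⟩
        sumℕ b indicator                ≡⟨ sumℕ-cong b (λ k → indicator≡colBit (suc k)) ⟩
        sumℕ b (colBit p)               ≡⟨ sym (rk≡colBits b) ⟩
        rk p b                          ∎
        where open ≡-Reasoning

      M-length : length M ≡ p
      M-length = trans (sym (count-all n 0 M M-increasing M-bounded))
                       (trans (count-M n ℕP.≤-refl) (rk-full-width p p≤n))

    triangle-gword : gword n (mtPart A p) p ≡ M ++ complement n M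
    triangle-gword = subst (λ d → gword n (triangleShape M) d ≡ M ++ complement n M) M-length
                           (cong (λ X → X ++ complement n X) (leading-triangleShape M M-increasing))

    triangle-fits : Fits p j M
    triangle-fits = record
      { increasing  = M-increasing
      ; bounded     = M-bounded
      ; length≡     = M-length
      ; count-lower = λ b b≤n → ℕP.≤-reflexive (sym (count-M b b≤n))
      ; count-upper = λ b b≤n → subst (_≤ rk p j + (b ∸ j)) (sym (count-M b b≤n)) (rk-col-Lipschitz p b j)
      }

  private
    module Fitting {B : Mat n} {i j : ℕ} {F : List ℕ} (B≡ : B ≡ permMat (F ++ complement n F)) (fits : Fits i j F)
                   (a b : ℕ) (a≤n : a ≤ n) (b≤n : b ≤ n) where
      below : r A a b ℤ.≤ r B a b
      below = subst (λ C → r A a b ℤ.≤ r C a b) (sym B≡) (fits-below fits a b a≤n b≤n)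

      above : r B a b ℤ.≤ + (rk i j + (a ∸ i) + (b ∸ j))
      above = subst (λ C → r C a b ℤ.≤ + (rk i j + (a ∸ i) + (b ∸ j))) (sym B≡) (fits-above fits a b a≤n b≤n)

  rectangle-join : (E : List (ℕ × ℕ)) → (∀ i j → ((i , j) ∈ E) ⇔ Ess A i j) →
    (h : ℕ × ℕ → Mat n) → (∀ i j → h (i , j) ≡ permMat (gword n (rect ∣ + i - r A i j ∣ ∣ + j - r A i j ∣) i)) →
    A ≋ join (map h E)
  rectangle-join E E≡Ess h h≡ = essential-join E h below covers
    where
    open Rectangle
    h≡word : ∀ i j (ess : Ess A i j) → h (i , j) ≡ permMat (rectWord i j ess ++ complement n (rectWord i j ess))
    h≡word i j ess = trans (h≡ i j) (cong permMat (rect-gword i j ess))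

    below : ∀ x → x ∈ E → ∀ a b → a ≤ n → b ≤ n → r A a b ℤ.≤ r (h x) a b
    below (i , j) x∈ = Fitting.below (h≡word i j ess) (rect-fits i j ess)
      where ess = Equivalence.to (E≡Ess i j) x∈

    covers : ∀ i j → Ess A i j → Σ (ℕ × ℕ) λ x → x ∈ E ×
               (∀ a b → a ≤ n → b ≤ n → r (h x) a b ℤ.≤ + (rk i j + (a ∸ i) + (b ∸ j)))
    covers i j ess = (i , j) , Equivalence.from (E≡Ess i j) ess , Fitting.above (h≡word i j ess) (rect-fits i j ess)

  triangle-join : (P : List ℕ) → (∀ i → (i ∈ P) ⇔ ∃ (λ j → Ess A i j)) →
    (h : ℕ → Mat n) → (∀ p → h p ≡ permMat (gword n (mtPart A p) p)) →
    A ≋ join (map h P)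
  triangle-join P P≡rows h h≡ = essential-join P h below covers
    where
    open TriangleRow
    h≡word : ∀ p j (ess : Ess A p j) → h p ≡ permMat (mtRow A p ++ complement n (mtRow A p))
    h≡word p j ess = trans (h≡ p) (cong permMat (triangle-gword p j ess))

    below : ∀ p → p ∈ P → ∀ a b → a ≤ n → b ≤ n → r A a b ℤ.≤ r (h p) a b
    below p p∈ with Equivalence.to (P≡rows p) p∈
    ... | j , ess = Fitting.below (h≡word p j ess) (triangle-fits p j ess)

    covers : ∀ i j → Ess A i j → Σ ℕ λ p → p ∈ P ×
               (∀ a b → a ≤ n → b ≤ n → r (h p) a b ℤ.≤ + (rk i j + (a ∸ i) + (b ∸ j)))
    covers i j ess = i , Equivalence.from (P≡rows i) (j , ess) , Fitting.above (h≡word i j ess) (triangle-fits i j ess)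

-- Alam is the join over the mapped list, so each part is a reindexing of
-- rectangle-join / triangle-join.
proposition2p12 : (n : ℕ) (A : Mat n) → IsASM A →
    ((E : List (ℕ × ℕ)) → Unique E → (∀ i j → ((i , j) ∈ E) ⇔ Ess A i j) →
      A ≋ Alam n (map (λ { (i , j) → (rect ∣ + i - r A i j ∣ ∣ + j - r A i j ∣ , i) }) E))
    × ((P : List ℕ) → Unique P → (∀ i → (i ∈ P) ⇔ ∃ (λ j → Ess A i j)) →
      A ≋ Alam n (map (λ p → (mtPart A p , p)) P))
proposition2p12 n A asm =
  (λ E _ E≡Ess → subst (λ L → A ≋ join L) (ListP.map-∘ E) (rectangle-join E E≡Ess _ (λ i j → refl))) ,
  (λ P _ P≡rows → subst (λ L → A ≋ join L) (ListP.map-∘ P) (triangle-join P P≡rows _ (λ p → refl)))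
  where open Families A asm
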